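{- $$F_{\{132,321\}}(x,q,z)=F_{\{213,321\}}(x,q,z)=\frac{1-(1+q)z+2qz^2}{(1-z)(1-xz)(1-qz)}.$$
   Context: For permutations $\pi=\pi_1\cdots\pi_n\in\mathfrak{S}_n$ and $\sigma\in\mathfrak{S}_m$, $\pi$ contains $\sigma$ if there are indices $i_1<\dots<i_m$ such that $\pi_{i_1}\cdots\pi_{i_m}$ is in the same relative order as $\sigma$; otherwise $\pi$ avoids $\sigma$. For a set $\Sigma$ of patterns, $\mathfrak{S}_n(\Sigma)$ is the set of permutations in $\mathfrak{S}_n$ avoiding every pattern in $\Sigma$. $\mathrm{fp}(\pi)=|\{i:\pi_i=i\}|$, $\mathrm{exc}(\pi)=|\{i:\pi_i>i\}|$, and $F_\Sigma(x,q,z)=\sum_{n\ge0}\sum_{\pi\in\mathfrak{S}_n(\Sigma)}x^{\mathrm{fp}(\pi)}q^{\mathrm{exc}(\pi)}z^n$. -}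

module Defs where

open import Data.Nat as ℕ using (ℕ; zero; suc; _∸_)
open import Data.Fin as Fin using (Fin)
open import Data.Fin.Properties as FinP using (any?; all?)
open import Data.Vec as Vec using (Vec; []; _∷_; lookup)
open import Data.List as List using (List; []; _∷_; filter; length; concatMap; allFin)
open import Data.List.Relation.Unary.All as All using (All)
open import Data.Product using (Σ; ∃; _×_; _,_)
open import Data.Bool as Bool using (Bool)
open import Data.Integer as ℤ using (ℤ; +_)
open import Relation.Nullary using (Dec; yes; no; ¬_)
open import Relation.Nullary.Decidable using (⌊_⌋; _×-dec_; _→-dec_; ¬?)
open import Relation.Binary.PropositionalEquality using (_≡_)

-- Permutations of [n] are represented 0-indexed as words π = π₀ ⋯ π_{n-1}
-- (a Vec (Fin n) n) whose entries are pairwise distinct.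

IsPerm : ∀ {n} → Vec (Fin n) n → Set
IsPerm {n} π = ∀ (i j : Fin n) → lookup π i ≡ lookup π j → i ≡ j

isPerm? : ∀ {n} (π : Vec (Fin n) n) → Dec (IsPerm π)
isPerm? π = all? (λ i → all? (λ j → (lookup π i FinP.≟ lookup π j) →-dec (i FinP.≟ j)))

allWords : (m n : ℕ) → List (Vec (Fin n) m)
allWords zero    n = [] ∷ []
allWords (suc m) n = concatMap (λ v → List.map (_∷ v) (allFin n)) (allWords m n)

-- Statistics (0-indexed: position i is fixed iff π_i = i, an excedance iff π_i > i)

fp : ∀ {n} → Vec (Fin n) n → ℕ
fp {n} π = length (filter (λ i → lookup π i FinP.≟ i) (allFin n))

exc : ∀ {n} → Vec (Fin n) n → ℕ
exc {n} π = length (filter (λ i → i Fin.<? lookup π i) (allFin n))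

-- Pattern containment for patterns of length 3 (all patterns in the
-- statement have length 3).  A pattern σ ∈ 𝔖₃ is a Vec (Fin 3) 3, e.g.
-- 132 is 0 ∷ 2 ∷ 1 ∷ [].

SameOrder : ∀ {n} → Fin n → Fin n → Fin n → Vec (Fin 3) 3 → Set
SameOrder a b c σ =
  (⌊ a Fin.<? b ⌋ ≡ ⌊ lookup σ Fin.zero Fin.<? lookup σ (Fin.suc Fin.zero) ⌋) ×
  (⌊ a Fin.<? c ⌋ ≡ ⌊ lookup σ Fin.zero Fin.<? lookup σ (Fin.suc (Fin.suc Fin.zero)) ⌋) ×
  (⌊ b Fin.<? c ⌋ ≡ ⌊ lookup σ (Fin.suc Fin.zero) Fin.<? lookup σ (Fin.suc (Fin.suc Fin.zero)) ⌋)

sameOrder? : ∀ {n} (a b c : Fin n) (σ : Vec (Fin 3) 3) → Dec (SameOrder a b c σ)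
sameOrder? a b c σ = (_ Bool.≟ _) ×-dec ((_ Bool.≟ _) ×-dec (_ Bool.≟ _))

Contains : ∀ {n} → Vec (Fin n) n → Vec (Fin 3) 3 → Set
Contains {n} π σ =
  ∃ λ (i : Fin n) → ∃ λ (j : Fin n) → ∃ λ (k : Fin n) →
    (i Fin.< j) × (j Fin.< k) × SameOrder (lookup π i) (lookup π j) (lookup π k) σ

contains? : ∀ {n} (π : Vec (Fin n) n) (σ : Vec (Fin 3) 3) → Dec (Contains π σ)
contains? π σ = any? (λ i → any? (λ j → any? (λ k →
  (i Fin.<? j) ×-dec ((j Fin.<? k) ×-dec sameOrder? (lookup π i) (lookup π j) (lookup π k) σ))))

Avoids : ∀ {n} → Vec (Fin n) n → List (Vec (Fin 3) 3) → Set
Avoids π Σs = All (λ σ → ¬ Contains π σ) Σs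

avoids? : ∀ {n} (π : Vec (Fin n) n) (Σs : List (Vec (Fin 3) 3)) → Dec (Avoids π Σs)
avoids? π Σs = All.all? (λ σ → ¬? (contains? π σ)) Σs

count : List (Vec (Fin 3) 3) → (a b n : ℕ) → ℕ
count Σs a b n = length (filter
  (λ π → isPerm? π ×-dec (avoids? π Σs ×-dec ((fp π ℕ.≟ a) ×-dec (exc π ℕ.≟ b))))
  (allWords n n))

-- Formal power series in x, q, z with integer coefficients:
-- S a b n is the coefficient of x^a q^b z^n.

Series : Set
Series = ℕ → ℕ → ℕ → ℤ

sumTo : ℕ → (ℕ → ℤ) → ℤ
sumTo zero    f = f zero
sumTo (suc n) f = sumTo n f ℤ.+ f (suc n)

infixl 6 _⊕_ _⊖_
infixl 7 _⊛_

_⊕_ : Series → Series → Series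
(f ⊕ g) a b n = f a b n ℤ.+ g a b n

_⊖_ : Series → Series → Series
(f ⊖ g) a b n = f a b n ℤ.- g a b n

_⊛_ : Series → Series → Series
(f ⊛ g) a b n = sumTo a λ i → sumTo b λ j → sumTo n λ k →
  f i j k ℤ.* g (a ∸ i) (b ∸ j) (n ∸ k)

mono : ℕ → ℕ → ℕ → Series
mono a b n a′ b′ n′ with a ℕ.≟ a′ | b ℕ.≟ b′ | n ℕ.≟ n′
... | yes _ | yes _ | yes _ = + 1
... | _ | _ | _ = + 0

𝟙 X Q Z : Series
𝟙 = mono 0 0 0
X = mono 1 0 0
Q = mono 0 1 0
Z = mono 0 0 1

F : List (Vec (Fin 3) 3) → Series
F Σs a b n = + count Σs a b n

_≈ₛ_ : Series → Series → Set
f ≈ₛ g = ∀ a b n → f a b n ≡ g a b n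

p132 p213 p321 : Vec (Fin 3) 3
p132 = Fin.zero ∷ Fin.suc (Fin.suc Fin.zero) ∷ Fin.suc Fin.zero ∷ []
p213 = Fin.suc Fin.zero ∷ Fin.zero ∷ Fin.suc (Fin.suc Fin.zero) ∷ []
p321 = Fin.suc (Fin.suc Fin.zero) ∷ Fin.suc Fin.zero ∷ Fin.zero ∷ []

-- A permutation avoiding 132 and 321 has the form (K+1) ⋯ (K+J) 1 ⋯ K (J+K+1) ⋯ n, with J and K
-- both zero or both positive; it has n − J − K fixed points and J excedances. So the coefficient of
-- x^a q^b z^n in F_{132,321} is 1 when b = 0 and a = n or when b > 0 and a + b < n, and 0 otherwise.
-- Reverse-complement turns {213,321}-avoiders into {132,321}-avoiders, keeping fixed points and
-- exchanging excedances with deficiencies; as the block swap above has K deficiencies and K and J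
-- range over the same pairs, F_{213,321} has the same coefficients. Multiplying by
-- (1 − z)(1 − xz)(1 − qz) is then a finite check: 1 − xz kills every term with a positive power of x,
-- and the rest is 1 + qz² / ((1 − z)(1 − qz)).

module Submission where

open import Level using (Level)
open import Data.Nat using (ℕ; zero; suc; pred; _+_; _∸_; _≤_; _<_; _≤ᵇ_; z≤n; s≤s; s≤s⁻¹; _<?_)
open import Data.Nat.Properties
open import Data.Integer as ℤ using (ℤ; +_)
import Data.Integer.Properties as ℤ
open import Data.Integer.Tactic.RingSolver using (solve-∀)
open import Data.Fin as Fin using (Fin; toℕ; fromℕ<)
open import Data.Fin.Properties as FinP using (toℕ-fromℕ<; toℕ-injective; toℕ<n)
open import Data.Vec as Vec using (Vec; []; _∷_; lookup)
open import Data.Vec.Properties using (∷-injectiveˡ; ∷-injectiveʳ; lookup∘tabulate)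
open import Data.List as List using (List; []; _∷_; _++_; map; concatMap; filter; length; allFin)
open import Data.List.Properties using (filter-none)
open import Data.List.Relation.Unary.All using ([]; _∷_; universal)
open import Data.Product using (∃; ∃-syntax; ∃₂; _×_; _,_; proj₁; proj₂)
open import Data.Sum using (_⊎_; inj₁; inj₂)
open import Data.Bool using (Bool; true; false; T; not)
open import Data.Empty using (⊥; ⊥-elim)
open import Function using (_∘_; id)
open import Relation.Nullary using (Dec; yes; no; ¬_; contradiction)
open import Relation.Nullary.Decidable using (⌊_⌋; isYes≗does; dec-true; dec-false; toWitness; toWitnessFalse)
open import Relation.Unary using (Pred; Decidable)
open import Relation.Binary.Definitions using (tri<; tri≈; tri>)
open import Relation.Binary.PropositionalEquality
open import Defs

variable
  ℓ ℓ′ : Level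
  A : Set ℓ
  B : Set ℓ′

indicator : {P : Set ℓ} → Dec P → ℕ
indicator (yes _) = 1
indicator (no _)  = 0

indicator-yes : {P : Set ℓ} (d : Dec P) → P → indicator d ≡ 1
indicator-yes (yes _) _  = refl
indicator-yes (no ¬p) p = ⊥-elim (¬p p)

indicator-no : {P : Set ℓ} (d : Dec P) → ¬ P → indicator d ≡ 0
indicator-no (yes p) ¬p = ⊥-elim (¬p p)
indicator-no (no _)  _  = refl

sumBy : (A → ℕ) → List A → ℕ
sumBy f []       = 0
sumBy f (x ∷ xs) = f x + sumBy f xs

length-filter≡sumBy-indicator : {P : Pred A ℓ} (P? : Decidable P) (xs : List A) →
  length (filter P? xs) ≡ sumBy (indicator ∘ P?) xs
length-filter≡sumBy-indicator P? []       = refl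
length-filter≡sumBy-indicator P? (x ∷ xs) with P? x
... | yes _ = cong suc (length-filter≡sumBy-indicator P? xs)
... | no _  = length-filter≡sumBy-indicator P? xs

sumBy-++ : (f : A → ℕ) (xs ys : List A) → sumBy f (xs ++ ys) ≡ sumBy f xs + sumBy f ys
sumBy-++ f []       ys = refl
sumBy-++ f (x ∷ xs) ys = trans (cong (_+_ (f x)) (sumBy-++ f xs ys)) (sym (+-assoc (f x) _ _))

sumBy-zero : {f : A → ℕ} (xs : List A) → (∀ x → f x ≡ 0) → sumBy f xs ≡ 0
sumBy-zero []       f≡0 = refl
sumBy-zero (x ∷ xs) f≡0 = cong₂ _+_ (f≡0 x) (sumBy-zero xs f≡0)

sumBy-concatMap : (f : B → ℕ) (g : A → List B) (xs : List A) →
  sumBy f (concatMap g xs) ≡ sumBy (sumBy f ∘ g) xs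
sumBy-concatMap f g []       = refl
sumBy-concatMap f g (x ∷ xs) =
  trans (sumBy-++ f (g x) (concatMap g xs)) (cong (_+_ (sumBy f (g x))) (sumBy-concatMap f g xs))

sumBy-map : (f : B → ℕ) (g : A → B) (xs : List A) → sumBy f (map g xs) ≡ sumBy (f ∘ g) xs
sumBy-map f g []       = refl
sumBy-map f g (x ∷ xs) = cong (_+_ (f (g x))) (sumBy-map f g xs)

sumFin : ∀ n → (Fin n → ℕ) → ℕ
sumFin zero    g = 0
sumFin (suc n) g = g Fin.zero + sumFin n (g ∘ Fin.suc)

sumBy-tabulate : ∀ n (f : A → ℕ) (g : Fin n → A) →
  sumBy f (List.tabulate g) ≡ sumFin n (f ∘ g)
sumBy-tabulate zero    f g = refl
sumBy-tabulate (suc n) f g = cong (_+_ (f (g Fin.zero))) (sumBy-tabulate n f (g ∘ Fin.suc))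

sumFin-zero : ∀ n (g : Fin n → ℕ) → (∀ i → g i ≡ 0) → sumFin n g ≡ 0
sumFin-zero zero    g g≡0 = refl
sumFin-zero (suc n) g g≡0 = cong₂ _+_ (g≡0 Fin.zero) (sumFin-zero n (g ∘ Fin.suc) (g≡0 ∘ Fin.suc))

sumFin-single : ∀ n (g : Fin n → ℕ) i → g i ≡ 1 → (∀ j → j ≢ i → g j ≡ 0) → sumFin n g ≡ 1
sumFin-single (suc n) g Fin.zero gi≡1 g≡0 =
  cong₂ _+_ gi≡1 (sumFin-zero n (g ∘ Fin.suc) (λ j → g≡0 (Fin.suc j) (λ ())))
sumFin-single (suc n) g (Fin.suc i) gi≡1 g≡0 =
  cong₂ _+_ (g≡0 Fin.zero (λ ()))
    (sumFin-single n (g ∘ Fin.suc) i gi≡1 (λ j j≢i → g≡0 (Fin.suc j) (j≢i ∘ FinP.suc-injective)))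

sumFin-interval : ∀ n (g : Fin n → ℕ) lo hi → lo ≤ hi → hi ≤ n →
  (∀ i → lo ≤ toℕ i → toℕ i < hi → g i ≡ 1) →
  (∀ i → toℕ i < lo ⊎ hi ≤ toℕ i → g i ≡ 0) →
  sumFin n g ≡ hi ∸ lo
sumFin-interval zero    g zero     zero     _ _ _ _ = refl
sumFin-interval (suc n) g zero     zero     _ _ _ outside =
  sumFin-zero (suc n) g (λ i → outside i (inj₂ z≤n))
sumFin-interval (suc n) g zero     (suc hi) _ (s≤s hi≤n) inside outside =
  cong₂ _+_ (inside Fin.zero z≤n (s≤s z≤n))
    (sumFin-interval n (g ∘ Fin.suc) zero hi z≤n hi≤n
      (λ i _ i<hi → inside (Fin.suc i) z≤n (s≤s i<hi))
      (λ { i (inj₂ hi≤i) → outside (Fin.suc i) (inj₂ (s≤s hi≤i)) }))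
sumFin-interval (suc n) g (suc lo) (suc hi) (s≤s lo≤hi) (s≤s hi≤n) inside outside =
  cong₂ _+_ (outside Fin.zero (inj₁ (s≤s z≤n)))
    (sumFin-interval n (g ∘ Fin.suc) lo hi lo≤hi hi≤n
      (λ i lo≤i i<hi → inside (Fin.suc i) (s≤s lo≤i) (s≤s i<hi))
      (λ { i (inj₁ i<lo) → outside (Fin.suc i) (inj₁ (s≤s i<lo))
         ; i (inj₂ hi≤i) → outside (Fin.suc i) (inj₂ (s≤s hi≤i)) }))

sumBy-allWords-single : ∀ m n (f : Vec (Fin n) m → ℕ) t →
  f t ≡ 1 → (∀ w → w ≢ t → f w ≡ 0) → sumBy f (allWords m n) ≡ 1
sumBy-allWords-single zero    n f []      ft≡1 _   = trans (+-identityʳ (f [])) ft≡1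
sumBy-allWords-single (suc m) n f (x ∷ t) ft≡1 f≡0 =
  trans (sumBy-concatMap f (λ v → map (_∷ v) (allFin n)) (allWords m n))
    (sumBy-allWords-single m n _ t
      (trans (sumBy-map f (_∷ t) (allFin n))
        (trans (sumBy-tabulate n _ id)
          (sumFin-single n _ x ft≡1 (λ y y≢x → f≡0 (y ∷ t) (y≢x ∘ ∷-injectiveˡ)))))
      (λ v v≢t → trans (sumBy-map f (_∷ v) (allFin n))
        (sumBy-zero (allFin n) (λ y → f≡0 (y ∷ v) (v≢t ∘ ∷-injectiveʳ)))))

length-filter-allWords-unique : ∀ n {P : Pred (Vec (Fin n) n) ℓ} (P? : Decidable P) t →
  P t → (∀ w → P w → w ≡ t) → length (filter P? (allWords n n)) ≡ 1
length-filter-allWords-unique n P? t Pt unique =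
  trans (length-filter≡sumBy-indicator P? (allWords n n))
    (sumBy-allWords-single n n _ t (indicator-yes (P? t) Pt)
      (λ w w≢t → indicator-no (P? w) (w≢t ∘ unique w)))

length-filter-none : {P : Pred A ℓ} (P? : Decidable P) (xs : List A) →
  (∀ x → ¬ P x) → length (filter P? xs) ≡ 0
length-filter-none P? xs ¬P = cong length (filter-none P? (universal ¬P xs))

length-filter-allFin-interval : ∀ n {P : Pred (Fin n) ℓ} (P? : Decidable P) lo hi → lo ≤ hi → hi ≤ n →
  (∀ i → lo ≤ toℕ i → toℕ i < hi → P i) → (∀ i → P i → lo ≤ toℕ i × toℕ i < hi) →
  length (filter P? (allFin n)) ≡ hi ∸ lo
length-filter-allFin-interval n P? lo hi lo≤hi hi≤n inside⇒P P⇒inside =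
  trans (length-filter≡sumBy-indicator P? (allFin n))
    (trans (sumBy-tabulate n _ id)
      (sumFin-interval n _ lo hi lo≤hi hi≤n
        (λ i lo≤i i<hi → indicator-yes (P? i) (inside⇒P i lo≤i i<hi))
        (λ i outside → indicator-no (P? i) (λ Pi → outside⇏P outside (P⇒inside i Pi)))))
  where
  outside⇏P : ∀ {i : ℕ} → i < lo ⊎ hi ≤ i → ¬ (lo ≤ i × i < hi)
  outside⇏P (inj₁ i<lo) (lo≤i , _) = <⇒≱ i<lo lo≤i
  outside⇏P (inj₂ hi≤i) (_ , i<hi) = <⇒≱ i<hi hi≤i

-- Permutations as functions on ℕ, and block swaps

MapsInto InjectiveOn SurjectiveOn : ℕ → (ℕ → ℕ) → Set
MapsInto n f = ∀ m → m < n → f m < n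
InjectiveOn n f = ∀ p q → p < n → q < n → f p ≡ f q → p ≡ q
SurjectiveOn n f = ∀ v → v < n → ∃[ p ] p < n × f p ≡ v

AgreeOn : ℕ → (ℕ → ℕ) → (ℕ → ℕ) → Set
AgreeOn n f g = ∀ m → m < n → f m ≡ g m

Avoids132 Avoids321 Avoids213 : ℕ → (ℕ → ℕ) → Set
Avoids132 n f = ∀ p q r → p < q → q < r → r < n → f p < f r → f r < f q → ⊥
Avoids321 n f = ∀ p q r → p < q → q < r → r < n → f q < f p → f r < f q → ⊥
Avoids213 n f = ∀ p q r → p < q → q < r → r < n → f q < f p → f p < f r → ⊥

-- In one-line notation (1-indexed): (K+1) ⋯ (K+J) 1 ⋯ K (J+K+1) ⋯ n.
swapBlocks : ℕ → ℕ → ℕ → ℕ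
swapBlocks J K m with m <? J
... | yes _ = K + m
... | no _ with m ∸ J <? K
...   | yes _ = m ∸ J
...   | no _  = m

-- Exactly one empty block also gives the identity; excluding it makes (J, K) determined by the permutation.
CanonicalBlocks : ℕ → ℕ → Set
CanonicalBlocks J K = (J ≡ 0 × K ≡ 0) ⊎ (0 < J × 0 < K)

canonicalBlocks-sym : ∀ {J K} → CanonicalBlocks J K → CanonicalBlocks K J
canonicalBlocks-sym (inj₁ (J≡0 , K≡0)) = inj₁ (K≡0 , J≡0)
canonicalBlocks-sym (inj₂ (0<J , 0<K)) = inj₂ (0<K , 0<J)

canonicalBlocks-positive : ∀ {J K} → CanonicalBlocks J K → 0 < J → 0 < K
canonicalBlocks-positive (inj₁ (refl , _)) ()
canonicalBlocks-positive (inj₂ (_ , 0<K)) _ = 0<K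

canonicalBlocks-zero : ∀ {J K} → CanonicalBlocks J K → K ≡ 0 → J ≡ 0
canonicalBlocks-zero (inj₁ (J≡0 , _)) _    = J≡0
canonicalBlocks-zero (inj₂ (_ , ())) refl

data SwapBlocksView (J K m : ℕ) : Set where
  first  : m < J → swapBlocks J K m ≡ K + m → SwapBlocksView J K m
  second : J ≤ m → m ∸ J < K → swapBlocks J K m ≡ m ∸ J → SwapBlocksView J K m
  fixed  : J ≤ m → K ≤ m ∸ J → swapBlocks J K m ≡ m → SwapBlocksView J K m

private
  swapBlocks-first′ : ∀ J K m → m < J → swapBlocks J K m ≡ K + m
  swapBlocks-first′ J K m m<J with m <? J
  ... | yes _   = refl
  ... | no m≮J = ⊥-elim (m≮J m<J)

  swapBlocks-second′ : ∀ J K m → J ≤ m → m ∸ J < K → swapBlocks J K m ≡ m ∸ J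
  swapBlocks-second′ J K m J≤m m∸J<K with m <? J
  ... | yes m<J = ⊥-elim (<⇒≱ m<J J≤m)
  ... | no _ with m ∸ J <? K
  ...   | yes _      = refl
  ...   | no m∸J≮K = ⊥-elim (m∸J≮K m∸J<K)

  swapBlocks-fixed′ : ∀ J K m → J ≤ m → K ≤ m ∸ J → swapBlocks J K m ≡ m
  swapBlocks-fixed′ J K m J≤m K≤m∸J with m <? J
  ... | yes m<J = ⊥-elim (<⇒≱ m<J J≤m)
  ... | no _ with m ∸ J <? K
  ...   | yes m∸J<K = ⊥-elim (<⇒≱ m∸J<K K≤m∸J)
  ...   | no _      = refl

swapBlocksView : ∀ J K m → SwapBlocksView J K m
swapBlocksView J K m with m <? J
... | yes m<J = first m<J (swapBlocks-first′ J K m m<J)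
... | no m≮J with m ∸ J <? K
...   | yes m∸J<K = second (≮⇒≥ m≮J) m∸J<K (swapBlocks-second′ J K m (≮⇒≥ m≮J) m∸J<K)
...   | no m∸J≮K  = fixed (≮⇒≥ m≮J) (≮⇒≥ m∸J≮K) (swapBlocks-fixed′ J K m (≮⇒≥ m≮J) (≮⇒≥ m∸J≮K))

swapBlocks-first : ∀ {J K m} → m < J → swapBlocks J K m ≡ K + m
swapBlocks-first {J} {K} {m} = swapBlocks-first′ J K m

swapBlocks-fixed : ∀ {J K m} → J + K ≤ m → swapBlocks J K m ≡ m
swapBlocks-fixed {J} {K} {m} J+K≤m =
  swapBlocks-fixed′ J K m (≤-trans (m≤m+n J K) J+K≤m) (subst (_≤ m ∸ J) (m+n∸m≡n J K) (∸-monoˡ-≤ J J+K≤m))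

≤∸⇒+≤ : ∀ J K m → J ≤ m → K ≤ m ∸ J → J + K ≤ m
≤∸⇒+≤ J K m J≤m K≤m∸J = subst (_≤ m) (+-comm K J) (m≤o∸n⇒m+n≤o K J≤m K≤m∸J)

∸<⇒< : ∀ J K m → J ≤ m → m ∸ J < K → m < J + K
∸<⇒< J K m J≤m m∸J<K = subst (_< J + K) (m+[n∸m]≡n J≤m) (+-monoʳ-< J m∸J<K)

second-block-decreasing : ∀ {J K m} → CanonicalBlocks J K → J ≤ m → m ∸ J < K → m ∸ J < m
second-block-decreasing {zero}  (inj₁ (_ , refl)) _ ()
second-block-decreasing {zero}  (inj₂ (() , _))
second-block-decreasing {suc J} _ J≤m _ = ∸-monoʳ-< (s≤s z≤n) J≤m

module SwapBlocks {J K : ℕ} (canonical : CanonicalBlocks J K) where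

  private
    σ : ℕ → ℕ
    σ = swapBlocks J K

    0<K : ∀ {m} → m < J → 0 < K
    0<K m<J = canonicalBlocks-positive canonical (≤-<-trans z≤n m<J)

  maps-into : ∀ {n} → J + K ≤ n → MapsInto n σ
  maps-into {n} J+K≤n m m<n with swapBlocksView J K m
  ... | first m<J e = subst (_< n) (sym e) (<-≤-trans (+-monoʳ-< K m<J) (subst (_≤ n) (+-comm J K) J+K≤n))
  ... | second _ _ e = subst (_< n) (sym e) (≤-<-trans (m∸n≤m m J) m<n)
  ... | fixed _ _ e = subst (_< n) (sym e) m<n

  first-increasing : ∀ p q → p < q → q < J → σ p < σ q
  first-increasing p q p<q q<J =
    subst₂ _<_ (sym (swapBlocks-first (<-trans p<q q<J))) (sym (swapBlocks-first q<J)) (+-monoʳ-< K p<q)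

  increasing-after : ∀ p q → J < p → p < q → σ p < σ q
  increasing-after p q J<p p<q with swapBlocksView J K p | swapBlocksView J K q
  ... | first p<J _     | _               = ⊥-elim (<-asym p<J J<p)
  ... | _               | first q<J _     = ⊥-elim (<-asym q<J (<-trans J<p p<q))
  ... | second J≤p _ e  | second _ _ f    = subst₂ _<_ (sym e) (sym f) (∸-monoˡ-< p<q J≤p)
  ... | second _ p∸J<K e | fixed _ K≤q∸J f = subst₂ _<_ (sym e) (sym f) (<-≤-trans p∸J<K (≤-trans K≤q∸J (m∸n≤m q J)))
  ... | fixed _ K≤p∸J _ | second _ q∸J<K _ = ⊥-elim (<⇒≱ q∸J<K (≤-trans K≤p∸J (∸-monoˡ-≤ J (<⇒≤ p<q))))
  ... | fixed _ _ e     | fixed _ _ f     = subst₂ _<_ (sym e) (sym f) p<q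

  at-J : σ J ≡ 0
  at-J with swapBlocksView J K J
  ... | first J<J _  = ⊥-elim (<-irrefl refl J<J)
  ... | second _ _ e = trans e (n∸n≡0 J)
  ... | fixed _ K≤J∸J e = trans e (canonicalBlocks-zero canonical (≤-antisym (subst (K ≤_) (n∸n≡0 J) K≤J∸J) z≤n))

  positive : ∀ m → m ≢ J → 0 < σ m
  positive m m≢J with swapBlocksView J K m
  ... | first m<J e = subst (0 <_) (sym e) (<-≤-trans (0<K m<J) (m≤m+n K m))
  ... | second J≤m _ e = subst (0 <_) (sym e) (m<n⇒0<n∸m (≤∧≢⇒< J≤m (m≢J ∘ sym)))
  ... | fixed J≤m _ e = subst (0 <_) (sym e) (≤-<-trans z≤n (≤∧≢⇒< J≤m (m≢J ∘ sym)))

  first-in-block : ∀ m → m < J → K ≤ σ m × σ m < K + J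
  first-in-block m m<J = subst (K ≤_) (sym e) (m≤m+n K m) , subst (_< K + J) (sym e) (+-monoʳ-< K m<J)
    where e = swapBlocks-first {K = K} m<J

  after-not-in-block : ∀ m → J < m → K ≤ σ m → σ m < K + J → ⊥
  after-not-in-block m J<m K≤σm σm<K+J with swapBlocksView J K m
  ... | first m<J _ = <-asym m<J J<m
  ... | second _ m∸J<K e = <⇒≱ (subst (_< K) (sym e) m∸J<K) K≤σm
  ... | fixed J≤m K≤m∸J e =
    <⇒≱ σm<K+J (subst (K + J ≤_) (sym e) (subst (_≤ m) (+-comm J K) (≤∸⇒+≤ J K m J≤m K≤m∸J)))

  private
    distinct : ∀ p q → p < q → σ p ≢ σ q
    distinct p q p<q eq with <-cmp q J
    ... | tri< q<J _ _  = <-irrefl eq (first-increasing p q p<q q<J)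
    ... | tri≈ _ refl _ = <-irrefl (sym (trans eq at-J)) (positive p (<⇒≢ p<q))
    ... | tri> _ _ J<q with <-cmp p J
    ...   | tri< p<J _ _  = after-not-in-block q J<q (subst (K ≤_) eq (proj₁ (first-in-block p p<J)))
                              (subst (_< K + J) eq (proj₂ (first-in-block p p<J)))
    ...   | tri≈ _ refl _ = <-irrefl (trans (sym at-J) eq) (positive q (>⇒≢ J<q))
    ...   | tri> _ _ J<p  = <-irrefl eq (increasing-after p q J<p p<q)

  injective : ∀ {n} → InjectiveOn n σ
  injective p q _ _ eq with <-cmp p q
  ... | tri< p<q _ _ = ⊥-elim (distinct p q p<q eq)
  ... | tri≈ _ p≡q _ = p≡q
  ... | tri> _ _ q<p = ⊥-elim (distinct q p q<p (sym eq))

  avoids321 : ∀ {n} → Avoids321 n σ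
  avoids321 p q r p<q q<r _ σq<σp σr<σq with <-cmp q J
  ... | tri< q<J _ _  = <-asym σq<σp (first-increasing p q p<q q<J)
  ... | tri≈ _ refl _ = <⇒≱ (subst (σ r <_) at-J σr<σq) z≤n
  ... | tri> _ _ J<q  = <-asym σr<σq (increasing-after q r J<q q<r)

  avoids132 : ∀ {n} → Avoids132 n σ
  avoids132 p q r p<q q<r _ σp<σr σr<σq with <-cmp q J
  ... | tri> _ _ J<q  = <-asym σr<σq (increasing-after q r J<q q<r)
  ... | tri≈ _ refl _ = <⇒≱ (subst (σ r <_) at-J σr<σq) z≤n
  ... | tri< q<J _ _ with <-cmp r J
  ...   | tri< r<J _ _  = <-asym σr<σq (first-increasing q r q<r r<J)
  ...   | tri≈ _ refl _ = <⇒≱ (subst (σ p <_) at-J σp<σr) z≤n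
  ...   | tri> _ _ J<r  = after-not-in-block r J<r
                            (≤-trans (proj₁ (first-in-block p (<-trans p<q q<J))) (<⇒≤ σp<σr))
                            (<-trans σr<σq (proj₂ (first-in-block q q<J)))

  fixed⇒ : ∀ m → σ m ≡ m → J + K ≤ m
  fixed⇒ m σm≡m with swapBlocksView J K m
  ... | first m<J e = ⊥-elim (<-irrefl (sym (trans (sym e) σm≡m)) (m<n+m m (0<K m<J)))
  ... | second J≤m m∸J<K e = ⊥-elim (<-irrefl (trans (sym e) σm≡m) (second-block-decreasing canonical J≤m m∸J<K))
  ... | fixed J≤m K≤m∸J _ = ≤∸⇒+≤ J K m J≤m K≤m∸J

  excedance⇒ : ∀ m → m < σ m → m < J
  excedance⇒ m m<σm with swapBlocksView J K m
  ... | first m<J _ = m<J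
  ... | second _ _ e = ⊥-elim (<⇒≱ (subst (m <_) e m<σm) (m∸n≤m m J))
  ... | fixed _ _ e = ⊥-elim (<-irrefl (sym e) m<σm)

  excedance⇐ : ∀ m → m < J → m < σ m
  excedance⇐ m m<J = subst (m <_) (sym (swapBlocks-first m<J)) (m<n+m m (0<K m<J))

  deficiency⇒ : ∀ m → σ m < m → J ≤ m × m < J + K
  deficiency⇒ m σm<m with swapBlocksView J K m
  ... | first m<J e = ⊥-elim (<-asym σm<m (subst (m <_) (sym e) (m<n+m m (0<K m<J))))
  ... | second J≤m m∸J<K _ = J≤m , ∸<⇒< J K m J≤m m∸J<K
  ... | fixed _ _ e = ⊥-elim (<-irrefl e σm<m)

  deficiency⇐ : ∀ m → J ≤ m → m < J + K → σ m < m
  deficiency⇐ m J≤m m<J+K with swapBlocksView J K m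
  ... | first m<J _ = ⊥-elim (<⇒≱ m<J J≤m)
  ... | second J≤m m∸J<K e = subst (_< m) (sym e) (second-block-decreasing canonical J≤m m∸J<K)
  ... | fixed J≤m K≤m∸J _ = ⊥-elim (<⇒≱ m<J+K (≤∸⇒+≤ J K m J≤m K≤m∸J))

  step-increasing : ∀ m → J ≤ m → σ m < σ (suc m)
  step-increasing m J≤m with m≤n⇒m<n∨m≡n J≤m
  ... | inj₁ J<m = increasing-after m (suc m) J<m (n<1+n m)
  ... | inj₂ refl = subst (_< σ (suc m)) (sym at-J) (positive (suc m) (1+n≢n))

  gap-in-block : ∀ m w → J ≤ m → σ m < w → w < σ (suc m) → K ≤ w × w < K + J
  gap-in-block m w J≤m σm<w w<σsm with swapBlocksView J K m | swapBlocksView J K (suc m)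
  ... | first m<J _ | _ = ⊥-elim (<⇒≱ m<J J≤m)
  ... | _ | first sm<J _ = ⊥-elim (<⇒≱ sm<J (m≤n⇒m≤1+n J≤m))
  ... | second _ _ e | second _ _ e′ =
    ⊥-elim (<⇒≱ (subst (w <_) (trans e′ (+-∸-assoc 1 J≤m)) w<σsm) (subst (_< w) e σm<w))
  ... | second _ m∸J<K e | fixed _ K≤sm∸J e′ =
    ≤-trans (subst (K ≤_) (+-∸-assoc 1 J≤m) K≤sm∸J) (subst (_< w) e σm<w) ,
    <-≤-trans (subst (w <_) e′ w<σsm) (subst (suc m ≤_) (+-comm J K) (∸<⇒< J K m J≤m m∸J<K))
  ... | fixed _ K≤m∸J _ | second _ sm∸J<K _ =
    ⊥-elim (<⇒≱ sm∸J<K (≤-trans K≤m∸J (∸-monoˡ-≤ J (n≤1+n m))))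
  ... | fixed _ _ e | fixed _ _ e′ = ⊥-elim (<⇒≱ (subst (w <_) e′ w<σsm) (subst (_< w) e σm<w))

-- {132, 321}-avoiders are block swaps

least-above-unique : ∀ {b} {B : ℕ → Set b} {a x y} → a < x → a < y → ¬ B x → ¬ B y →
  (∀ w → a < w → w < x → B w) → (∀ w → a < w → w < y → B w) → x ≡ y
least-above-unique {x = x} {y} a<x a<y ¬Bx ¬By below-x below-y with <-cmp x y
... | tri< x<y _ _  = ⊥-elim (¬Bx (below-y x a<x x<y))
... | tri≈ _ x≡y _ = x≡y
... | tri> _ _ y<x  = ⊥-elim (¬By (below-x y a<y y<x))

-- The entries before the 0 increase (no 321 through the 0), those after it increase (no 132 starting
-- at the 0), and a value between two entries before the 0 that occurred after it would complete a 132;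
-- so the entries before the 0 are a block K, K+1, … of consecutive values and f = swapBlocks z K.
module AvoiderStructure {n} {f : ℕ → ℕ} (maps : MapsInto n f) (inj : InjectiveOn n f) (surj : SurjectiveOn n f)
  (avoids132 : Avoids132 n f) (avoids321 : Avoids321 n f) (0<n : 0 < n) where

  z : ℕ
  z = proj₁ (surj 0 0<n)

  z<n : z < n
  z<n = proj₁ (proj₂ (surj 0 0<n))

  f[z]≡0 : f z ≡ 0
  f[z]≡0 = proj₂ (proj₂ (surj 0 0<n))

  K : ℕ
  K = f 0

  private
    <z⇒<n : ∀ {p} → p < z → p < n
    <z⇒<n p<z = <-trans p<z z<n

    f[z]<f : ∀ p → p < n → p ≢ z → f z < f p
    f[z]<f p p<n p≢z =
      subst (_< f p) (sym f[z]≡0) (n≢0⇒n>0 (p≢z ∘ λ f[p]≡0 → inj p z p<n z<n (trans f[p]≡0 (sym f[z]≡0))))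

    f-<-or-> : ∀ p q → p < n → q < n → p ≢ q → f p < f q ⊎ f q < f p
    f-<-or-> p q p<n q<n p≢q with <-cmp (f p) (f q)
    ... | tri< fp<fq _ _ = inj₁ fp<fq
    ... | tri≈ _ fp≡fq _ = ⊥-elim (p≢q (inj p q p<n q<n fp≡fq))
    ... | tri> _ _ fq<fp = inj₂ fq<fp

  increasing-before : ∀ p q → p < q → q < z → f p < f q
  increasing-before p q p<q q<z with f-<-or-> p q (<z⇒<n (<-trans p<q q<z)) (<z⇒<n q<z) (<⇒≢ p<q)
  ... | inj₁ fp<fq = fp<fq
  ... | inj₂ fq<fp = ⊥-elim (avoids321 p q z p<q q<z z<n fq<fp (f[z]<f q (<z⇒<n q<z) (<⇒≢ q<z)))

  increasing-after : ∀ p q → z < p → p < q → q < n → f p < f q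
  increasing-after p q z<p p<q q<n with f-<-or-> p q (<-trans p<q q<n) q<n (<⇒≢ p<q)
  ... | inj₁ fp<fq = fp<fq
  ... | inj₂ fq<fp = ⊥-elim (avoids132 z p q z<p p<q q<n (f[z]<f q q<n (>⇒≢ (<-trans z<p p<q))) fq<fp)

  private
    increasing-before⁻¹ : ∀ p q → p < z → q < z → f p < f q → p < q
    increasing-before⁻¹ p q p<z q<z fp<fq with <-cmp p q
    ... | tri< p<q _ _  = p<q
    ... | tri≈ _ refl _ = ⊥-elim (<-irrefl refl fp<fq)
    ... | tri> _ _ q<p  = ⊥-elim (<-asym fp<fq (increasing-before q p q<p p<z))

    consecutive-before : ∀ m → suc m < z → f (suc m) ≡ suc (f m)
    consecutive-before m sm<z = sym (≤∧≮⇒≡ (increasing-before m (suc m) (n<1+n m) sm<z) skipped)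
      where
      skipped : ¬ (suc (f m) < f (suc m))
      skipped fm<v<fsm with surj (suc (f m)) (<-trans fm<v<fsm (maps (suc m) (<z⇒<n sm<z)))
      ... | p , p<n , f[p]≡v with <-cmp p z
      ...   | tri< p<z _ _ =
        <⇒≱ (increasing-before⁻¹ m p (<-trans (n<1+n m) sm<z) p<z (subst (f m <_) (sym f[p]≡v) (n<1+n (f m))))
            (s≤s⁻¹ (increasing-before⁻¹ p (suc m) p<z sm<z (subst (_< f (suc m)) (sym f[p]≡v) fm<v<fsm)))
      ...   | tri≈ _ refl _ = 1+n≢0 (trans (sym f[p]≡v) f[z]≡0)
      ...   | tri> _ _ z<p = avoids132 m (suc m) p (n<1+n m) (<-trans sm<z z<p) p<n
                               (subst (f m <_) (sym f[p]≡v) (n<1+n (f m))) (subst (_< f (suc m)) (sym f[p]≡v) fm<v<fsm)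

  value-before : ∀ m → m < z → f m ≡ K + m
  value-before zero    _    = sym (+-identityʳ K)
  value-before (suc m) sm<z =
    trans (consecutive-before m sm<z) (trans (cong suc (value-before m (<-trans (n<1+n m) sm<z))) (sym (+-suc K m)))

  canonical : CanonicalBlocks z K
  canonical with z in z≡
  ... | zero  = inj₁ (refl , trans (cong f (sym z≡)) f[z]≡0)
  ... | suc _ = inj₂ (s≤s z≤n , subst (_< K) f[z]≡0 (f[z]<f 0 0<n (λ 0≡z → 1+n≢0 (sym (trans 0≡z z≡)))))

  fits : z + K ≤ n
  fits with z in z≡
  ... | zero   = subst (_≤ n) (sym (trans (cong f (sym z≡)) f[z]≡0)) z≤n
  ... | suc z′ = subst (_≤ n) (cong suc (+-comm K z′)) (subst (_< n) (value-before z′ z′<z) (maps z′ (<z⇒<n z′<z)))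
    where z′<z = subst (z′ <_) (sym z≡) (n<1+n z′)

  InBlock : ℕ → Set
  InBlock w = K ≤ w × w < K + z

  private
    in-block⇒before : ∀ {v} → InBlock v → v ∸ K < z × f (v ∸ K) ≡ v
    in-block⇒before {v} (K≤v , v<K+z) = v∸K<z , trans (value-before (v ∸ K) v∸K<z) (m+[n∸m]≡n K≤v)
      where v∸K<z = subst (v ∸ K <_) (m+n∸m≡n K z) (∸-monoˡ-< v<K+z K≤v)

  after-not-in-block : ∀ p → z < p → p < n → ¬ InBlock (f p)
  after-not-in-block p z<p p<n in-block = <-asym z<p (subst (_< z) p′≡p p′<z)
    where
    p′<z = proj₁ (in-block⇒before in-block)
    p′≡p = inj _ p (<z⇒<n p′<z) p<n (proj₂ (in-block⇒before in-block))

  step-increasing : ∀ m → z ≤ m → suc m < n → f m < f (suc m)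
  step-increasing m z≤m sm<n with m≤n⇒m<n∨m≡n z≤m
  ... | inj₁ z<m  = increasing-after m (suc m) z<m (n<1+n m) sm<n
  ... | inj₂ refl = f[z]<f (suc m) sm<n 1+n≢n

  gap-in-block : ∀ m w → z ≤ m → suc m < n → f m < w → w < f (suc m) → InBlock w
  gap-in-block m w z≤m sm<n fm<w w<fsm with surj w (<-trans w<fsm (maps (suc m) sm<n))
  ... | p , p<n , f[p]≡w with <-cmp p z
  ...   | tri< p<z _ _ = subst InBlock (trans (sym (value-before p p<z)) f[p]≡w) (m≤m+n K p , +-monoʳ-< K p<z)
  ...   | tri≈ _ refl _ = ⊥-elim (<⇒≱ fm<w (subst (_≤ f m) (trans (sym f[z]≡0) f[p]≡w) z≤n))
  ...   | tri> _ _ z<p with <-cmp p m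
  ...     | tri< p<m _ _  = ⊥-elim (<-asym fm<w (subst (_< f m) f[p]≡w (increasing-after p m z<p p<m (<-trans (n<1+n m) sm<n))))
  ...     | tri≈ _ refl _ = ⊥-elim (<-irrefl f[p]≡w fm<w)
  ...     | tri> _ _ m<p with <-cmp p (suc m)
  ...       | tri< p<sm _ _  = ⊥-elim (<⇒≱ p<sm m<p)
  ...       | tri≈ _ refl _ = ⊥-elim (<-irrefl (sym f[p]≡w) w<fsm)
  ...       | tri> _ _ sm<p  = ⊥-elim (<-asym w<fsm (subst (f (suc m) <_) f[p]≡w (increasing-after (suc m) p (s≤s z≤m) sm<p p<n)))

  private
    module σ = SwapBlocks canonical

  -- f(m+1) and swapBlocks z K (m+1) are both the least value above f m = swapBlocks z K m outside the block.
  value-from : ∀ m → z ≤ m → m < n → f m ≡ swapBlocks z K m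
  value-from m z≤m m<n with m≤n⇒m<n∨m≡n z≤m
  ... | inj₂ refl = trans f[z]≡0 (sym σ.at-J)
  value-from (suc m) _ sm<n | inj₁ (s≤s z≤m) =
    least-above-unique
      (step-increasing m z≤m sm<n)
      (subst (_< swapBlocks z K (suc m)) (sym IH) (σ.step-increasing m z≤m))
      (λ (K≤ , <K+z) → after-not-in-block (suc m) (s≤s z≤m) sm<n (K≤ , <K+z))
      (λ (K≤ , <K+z) → σ.after-not-in-block (suc m) (s≤s z≤m) K≤ <K+z)
      (λ w fm<w w<x → gap-in-block m w z≤m sm<n fm<w w<x)
      (λ w fm<w w<y → σ.gap-in-block m w z≤m (subst (_< w) IH fm<w) w<y)
    where IH = value-from m z≤m (<-trans (n<1+n m) sm<n)

  agrees : AgreeOn n f (swapBlocks z K)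
  agrees m m<n with <-cmp m z
  ... | tri< m<z _ _ = trans (value-before m m<z) (sym (swapBlocks-first m<z))
  ... | tri≈ _ m≡z _ = value-from m (≤-reflexive (sym m≡z)) m<n
  ... | tri> _ _ z<m = value-from m (<⇒≤ z<m) m<n

-- Reverse-complement

reverseComplement : ℕ → (ℕ → ℕ) → ℕ → ℕ
reverseComplement n f m = pred n ∸ f (pred n ∸ m)

reflect-< : ∀ {n} m → m < n → pred n ∸ m < n
reflect-< {suc n} m _ = s≤s (m∸n≤m n m)

reflect-≤ : ∀ {n m a} → m < n → a ≤ pred n ∸ m → m < n ∸ a
reflect-≤ {suc n} {m} {a} (s≤s m≤n) a≤n∸m =
  m+n≤o⇒m≤o∸n (suc m) (s≤s (subst (_≤ n) (+-comm a m) (m≤o∸n⇒m+n≤o a m≤n a≤n∸m)))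

reflect-≤⁻¹ : ∀ {n m a} → m < n ∸ a → a ≤ pred n ∸ m
reflect-≤⁻¹ {zero}  {m} {a} m<0∸a = contradiction (subst (m <_) (0∸n≡0 a) m<0∸a) λ ()
reflect-≤⁻¹ {suc n} {m} {a} m<n∸a =
  m+n≤o⇒m≤o∸n a (subst (_≤ n) (+-comm m a) (s≤s⁻¹ (m≤o∸n⇒m+n≤o (suc m) a≤n m<n∸a)))
  where a≤n = <⇒≤ (m∸n≢0⇒n<m (m<n⇒n≢0 m<n∸a))

module ReverseComplement {n} {f : ℕ → ℕ} (maps : MapsInto n f) where

  private
    N = pred n
    f^rc = reverseComplement n f

    f≤N : ∀ {m} → m < n → f m ≤ N
    f≤N m<n = <⇒≤pred (maps _ m<n)

    reflect-twice : ∀ {m} → m < n → N ∸ (N ∸ m) ≡ m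
    reflect-twice m<n = m∸[m∸n]≡n (<⇒≤pred m<n)

    reflect-positions : ∀ {p q} → p < q → q < n → N ∸ q < N ∸ p
    reflect-positions p<q q<n = ∸-monoʳ-< p<q (<⇒≤pred q<n)

    reflect-values : ∀ {x y} → N ∸ f x < N ∸ f y → f y < f x
    reflect-values = ∸-cancelʳ-<

  maps-into : MapsInto n f^rc
  maps-into m m<n = ≤-<-trans (m∸n≤m N (f (N ∸ m))) (reflect-< 0 (≤-<-trans z≤n m<n))

  injective : InjectiveOn n f → InjectiveOn n f^rc
  injective inj p q p<n q<n eq =
    ∸-cancelˡ-≡ (<⇒≤pred p<n) (<⇒≤pred q<n)
      (inj _ _ (reflect-< p p<n) (reflect-< q q<n) (∸-cancelˡ-≡ (f≤N (reflect-< p p<n)) (f≤N (reflect-< q q<n)) eq))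

  surjective : SurjectiveOn n f → SurjectiveOn n f^rc
  surjective surj v v<n with surj (N ∸ v) (reflect-< v v<n)
  ... | p , p<n , f[p]≡N∸v = N ∸ p , reflect-< p p<n ,
    trans (cong (λ x → N ∸ f x) (reflect-twice p<n)) (trans (cong (N ∸_) f[p]≡N∸v) (reflect-twice v<n))

  involutive : AgreeOn n (reverseComplement n f^rc) f
  involutive m m<n = trans (cong (λ x → N ∸ (N ∸ f x)) (reflect-twice m<n)) (m∸[m∸n]≡n (f≤N m<n))

  avoids132 : Avoids213 n f → Avoids132 n f^rc
  avoids132 avoids p q r p<q q<r r<n f^rc[p]<f^rc[r] f^rc[r]<f^rc[q] =
    avoids (N ∸ r) (N ∸ q) (N ∸ p) (reflect-positions q<r r<n) (reflect-positions p<q (<-trans q<r r<n))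
      (reflect-< p (<-trans p<q (<-trans q<r r<n))) (reflect-values f^rc[r]<f^rc[q]) (reflect-values f^rc[p]<f^rc[r])

  avoids213 : Avoids132 n f → Avoids213 n f^rc
  avoids213 avoids p q r p<q q<r r<n f^rc[q]<f^rc[p] f^rc[p]<f^rc[r] =
    avoids (N ∸ r) (N ∸ q) (N ∸ p) (reflect-positions q<r r<n) (reflect-positions p<q (<-trans q<r r<n))
      (reflect-< p (<-trans p<q (<-trans q<r r<n))) (reflect-values f^rc[p]<f^rc[r]) (reflect-values f^rc[q]<f^rc[p])

  avoids321 : Avoids321 n f → Avoids321 n f^rc
  avoids321 avoids p q r p<q q<r r<n f^rc[q]<f^rc[p] f^rc[r]<f^rc[q] =
    avoids (N ∸ r) (N ∸ q) (N ∸ p) (reflect-positions q<r r<n) (reflect-positions p<q (<-trans q<r r<n))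
      (reflect-< p (<-trans p<q (<-trans q<r r<n))) (reflect-values f^rc[r]<f^rc[q]) (reflect-values f^rc[q]<f^rc[p])

  fixed⇒ : ∀ m → m < n → f^rc m ≡ m → f (N ∸ m) ≡ N ∸ m
  fixed⇒ m m<n eq = trans (sym (m∸[m∸n]≡n (f≤N (reflect-< m m<n)))) (cong (N ∸_) eq)

  fixed⇐ : ∀ m → m < n → f (N ∸ m) ≡ N ∸ m → f^rc m ≡ m
  fixed⇐ m m<n eq = trans (cong (N ∸_) eq) (reflect-twice m<n)

  excedance⇒ : ∀ m → m < n → m < f^rc m → f (N ∸ m) < N ∸ m
  excedance⇒ m m<n m<f^rc[m] = ∸-cancelʳ-< (subst (_< f^rc m) (sym (reflect-twice m<n)) m<f^rc[m])

  excedance⇐ : ∀ m → m < n → f (N ∸ m) < N ∸ m → m < f^rc m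
  excedance⇐ m m<n lt = subst (_< f^rc m) (reflect-twice m<n) (∸-monoʳ-< lt (m∸n≤m N m))

reverseComplement-cong : ∀ {n f g} → AgreeOn n f g → AgreeOn n (reverseComplement n f) (reverseComplement n g)
reverseComplement-cong {n} agree m m<n = cong (pred n ∸_) (agree _ (reflect-< m m<n))

-- w as a function on ℕ, with junk value 0 beyond its length.
entry : ∀ {n k} → Vec (Fin n) k → ℕ → ℕ
entry []       _       = 0
entry (x ∷ xs) zero    = toℕ x
entry (x ∷ xs) (suc m) = entry xs m

injective⇒surjective : ∀ {n} (g : Fin n → Fin n) → (∀ i j → g i ≡ g j → i ≡ j) → ∀ v → ∃[ i ] g i ≡ v
injective⇒surjective {suc m} g inj v with FinP.any? (λ i → g i FinP.≟ v)
... | yes hit = hit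
... | no miss with FinP.pigeonhole (n<1+n m) (λ i → Fin.punchOut {i = v} {j = g i} (λ eq → miss (i , sym eq)))
...   | i , j , i<j , eq =
  ⊥-elim (<-irrefl (cong toℕ (inj i j (FinP.punchOut-injective (λ eq → miss (i , sym eq)) (λ eq → miss (j , sym eq)) eq))) i<j)

module _ {n : ℕ} where

  entry-lookup : ∀ {k} (w : Vec (Fin n) k) i → entry w (toℕ i) ≡ toℕ (lookup w i)
  entry-lookup (x ∷ w) Fin.zero    = refl
  entry-lookup (x ∷ w) (Fin.suc i) = entry-lookup w i

  lookup-fromℕ< : ∀ {k} (w : Vec (Fin n) k) {p} (p<k : p < k) → toℕ (lookup w (fromℕ< p<k)) ≡ entry w p
  lookup-fromℕ< w {p} p<k = trans (sym (entry-lookup w (fromℕ< p<k))) (cong (entry w) (toℕ-fromℕ< p<k))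

  entry-injective : ∀ {k} (w w′ : Vec (Fin n) k) → AgreeOn k (entry w) (entry w′) → w ≡ w′
  entry-injective []      []        _     = refl
  entry-injective (x ∷ w) (x′ ∷ w′) agree =
    cong₂ _∷_ (toℕ-injective (agree 0 (s≤s z≤n))) (entry-injective w w′ (λ m m<k → agree (suc m) (s≤s m<k)))

  entry-maps-into : (w : Vec (Fin n) n) → MapsInto n (entry w)
  entry-maps-into w m m<n = subst (_< n) (lookup-fromℕ< w m<n) (toℕ<n _)

  entry-injectiveOn : (w : Vec (Fin n) n) → IsPerm w → InjectiveOn n (entry w)
  entry-injectiveOn w perm p q p<n q<n eq =
    trans (sym (toℕ-fromℕ< p<n))
      (trans (cong toℕ (perm (fromℕ< p<n) (fromℕ< q<n)
                (toℕ-injective (trans (lookup-fromℕ< w p<n) (trans eq (sym (lookup-fromℕ< w q<n)))))))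
        (toℕ-fromℕ< q<n))

  entry-surjective : (w : Vec (Fin n) n) → IsPerm w → SurjectiveOn n (entry w)
  entry-surjective w perm v v<n with injective⇒surjective (lookup w) perm (fromℕ< v<n)
  ... | i , eq = toℕ i , toℕ<n i , trans (entry-lookup w i) (trans (cong toℕ eq) (toℕ-fromℕ< v<n))

  fromFunction : (f : ℕ → ℕ) → MapsInto n f → Vec (Fin n) n
  fromFunction f maps = Vec.tabulate (λ i → fromℕ< (maps (toℕ i) (toℕ<n i)))

  private
    lookup-fromFunction : ∀ f maps i → toℕ (lookup (fromFunction f maps) i) ≡ f (toℕ i)
    lookup-fromFunction f maps i = trans (cong toℕ (lookup∘tabulate _ i)) (toℕ-fromℕ< _)

  entry-fromFunction : ∀ f maps → AgreeOn n (entry (fromFunction f maps)) f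
  entry-fromFunction f maps m m<n =
    trans (sym (lookup-fromℕ< (fromFunction f maps) m<n))
      (trans (lookup-fromFunction f maps (fromℕ< m<n)) (cong f (toℕ-fromℕ< m<n)))

  fromFunction-isPerm : ∀ f maps → InjectiveOn n f → IsPerm (fromFunction f maps)
  fromFunction-isPerm f maps inj i j eq = toℕ-injective (inj _ _ (toℕ<n i) (toℕ<n j)
    (trans (sym (lookup-fromFunction f maps i)) (trans (cong toℕ eq) (lookup-fromFunction f maps j))))

module _ {n : ℕ} (w : Vec (Fin n) n) {f : ℕ → ℕ} (agree : AgreeOn n (entry w) f) where

  private
    lookup≡f : ∀ i → toℕ (lookup w i) ≡ f (toℕ i)
    lookup≡f i = trans (sym (entry-lookup w i)) (agree _ (toℕ<n i))

  fp-interval : ∀ lo hi → lo ≤ hi → hi ≤ n →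
    (∀ m → lo ≤ m → m < hi → f m ≡ m) → (∀ m → m < n → f m ≡ m → lo ≤ m × m < hi) → fp w ≡ hi ∸ lo
  fp-interval lo hi lo≤hi hi≤n inside⇒fixed fixed⇒inside =
    length-filter-allFin-interval n (λ i → lookup w i FinP.≟ i) lo hi lo≤hi hi≤n
      (λ i lo≤i i<hi → toℕ-injective (trans (lookup≡f i) (inside⇒fixed _ lo≤i i<hi)))
      (λ i eq → fixed⇒inside _ (toℕ<n i) (trans (sym (lookup≡f i)) (cong toℕ eq)))

  exc-interval : ∀ lo hi → lo ≤ hi → hi ≤ n →
    (∀ m → lo ≤ m → m < hi → m < f m) → (∀ m → m < n → m < f m → lo ≤ m × m < hi) → exc w ≡ hi ∸ lo
  exc-interval lo hi lo≤hi hi≤n inside⇒exceeds exceeds⇒inside =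
    length-filter-allFin-interval n (λ i → i Fin.<? lookup w i) lo hi lo≤hi hi≤n
      (λ i lo≤i i<hi → subst (toℕ i <_) (sym (lookup≡f i)) (inside⇒exceeds _ lo≤i i<hi))
      (λ i lt → exceeds⇒inside _ (toℕ<n i) (subst (toℕ i <_) (lookup≡f i) lt))

  private
    ascent : ∀ {i j} → ⌊ lookup w i Fin.<? lookup w j ⌋ ≡ true → f (toℕ i) < f (toℕ j)
    ascent {i} {j} bit = subst₂ _<_ (lookup≡f i) (lookup≡f j) (toWitness (subst T (sym bit) _))

    descent : IsPerm w → ∀ {i j} → i Fin.< j → ⌊ lookup w i Fin.<? lookup w j ⌋ ≡ false → f (toℕ j) < f (toℕ i)
    descent perm {i} {j} i<j bit = subst₂ _<_ (lookup≡f j) (lookup≡f i)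
      (≤∧≢⇒< (≮⇒≥ (toWitnessFalse (subst T (cong not (sym bit)) _)))
             (λ eq → <-irrefl (cong toℕ (perm i j (toℕ-injective (sym eq)))) i<j))

  avoids132⇒¬contains : IsPerm w → Avoids132 n f → ¬ Contains w p132
  avoids132⇒¬contains perm avoids (i , j , k , i<j , j<k , _ , ik , jk) =
    avoids (toℕ i) (toℕ j) (toℕ k) i<j j<k (toℕ<n k) (ascent ik) (descent perm j<k jk)

  avoids321⇒¬contains : IsPerm w → Avoids321 n f → ¬ Contains w p321
  avoids321⇒¬contains perm avoids (i , j , k , i<j , j<k , ij , _ , jk) =
    avoids (toℕ i) (toℕ j) (toℕ k) i<j j<k (toℕ<n k) (descent perm i<j ij) (descent perm j<k jk)

  avoids213⇒¬contains : IsPerm w → Avoids213 n f → ¬ Contains w p213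
  avoids213⇒¬contains perm avoids (i , j , k , i<j , j<k , ij , ik , _) =
    avoids (toℕ i) (toℕ j) (toℕ k) i<j j<k (toℕ<n k) (descent perm i<j ij) (ascent ik)

module _ {n : ℕ} (w : Vec (Fin n) n) where

  private
    yes< : ∀ {a b} → a < b → ⌊ a <? b ⌋ ≡ true
    yes< {a} {b} a<b = trans (isYes≗does (a <? b)) (dec-true (a <? b) a<b)

    no< : ∀ {a b} → b < a → ⌊ a <? b ⌋ ≡ false
    no< {a} {b} b<a = trans (isYes≗does (a <? b)) (dec-false (a <? b) (<-asym b<a))

    fromℕ<-mono : ∀ {p q} (p<n : p < n) (q<n : q < n) → p < q → fromℕ< p<n Fin.< fromℕ< q<n
    fromℕ<-mono p<n q<n = subst₂ _<_ (sym (toℕ-fromℕ< p<n)) (sym (toℕ-fromℕ< q<n))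

    bit : ∀ {p q} (p<n : p < n) (q<n : q < n) →
      ⌊ lookup w (fromℕ< p<n) Fin.<? lookup w (fromℕ< q<n) ⌋ ≡ ⌊ entry w p <? entry w q ⌋
    bit p<n q<n = cong₂ (λ a b → ⌊ a <? b ⌋) (lookup-fromℕ< w p<n) (lookup-fromℕ< w q<n)

    occurrence : ∀ σ {p q r} → p < q → q < r → r < n →
      ⌊ entry w p <? entry w q ⌋ ≡ ⌊ lookup σ Fin.zero Fin.<? lookup σ (Fin.suc Fin.zero) ⌋ →
      ⌊ entry w p <? entry w r ⌋ ≡ ⌊ lookup σ Fin.zero Fin.<? lookup σ (Fin.suc (Fin.suc Fin.zero)) ⌋ →
      ⌊ entry w q <? entry w r ⌋ ≡ ⌊ lookup σ (Fin.suc Fin.zero) Fin.<? lookup σ (Fin.suc (Fin.suc Fin.zero)) ⌋ →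
      Contains w σ
    occurrence σ p<q q<r r<n pq pr qr =
      fromℕ< p<n , fromℕ< q<n , fromℕ< r<n , fromℕ<-mono p<n q<n p<q , fromℕ<-mono q<n r<n q<r ,
      trans (bit p<n q<n) pq , trans (bit p<n r<n) pr , trans (bit q<n r<n) qr
      where
      q<n = <-trans q<r r<n
      p<n = <-trans p<q q<n

  ¬contains⇒avoids132 : ¬ Contains w p132 → Avoids132 n (entry w)
  ¬contains⇒avoids132 ¬occ p q r p<q q<r r<n wp<wr wr<wq =
    ¬occ (occurrence p132 p<q q<r r<n (yes< (<-trans wp<wr wr<wq)) (yes< wp<wr) (no< wr<wq))

  ¬contains⇒avoids321 : ¬ Contains w p321 → Avoids321 n (entry w)
  ¬contains⇒avoids321 ¬occ p q r p<q q<r r<n wq<wp wr<wq =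
    ¬occ (occurrence p321 p<q q<r r<n (no< wq<wp) (no< (<-trans wr<wq wq<wp)) (no< wr<wq))

  ¬contains⇒avoids213 : ¬ Contains w p213 → Avoids213 n (entry w)
  ¬contains⇒avoids213 ¬occ p q r p<q q<r r<n wq<wp wp<wr =
    ¬occ (occurrence p213 p<q q<r r<n (no< wq<wp) (yes< wp<wr) (yes< (<-trans wq<wp wp<wr)))

-- Counting avoiders by fixed points and excedances

less : ℕ → ℕ → ℕ
less b       zero    = 0
less zero    (suc n) = 1
less (suc b) (suc n) = less b n

-- The number of avoiders of size n with a fixed points and b excedances, 1 or 0 according to
-- Admissible a b n; defined by recursion so that the final coefficient comparison is mostly computation.
coefficient : ℕ → ℕ → ℕ → ℕ
coefficient zero    zero    zero    = 1
coefficient zero    zero    (suc n) = 0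
coefficient zero    (suc b) zero    = 0
coefficient zero    (suc b) (suc n) = less b n
coefficient (suc a) b       zero    = 0
coefficient (suc a) b       (suc n) = coefficient a b n

Admissible : ℕ → ℕ → ℕ → Set
Admissible a b n = (b ≡ 0 × a ≡ n) ⊎ (0 < b × a + b < n)

private
  less≡0⊎1 : ∀ b n → less b n ≡ 0 ⊎ less b n ≡ 1
  less≡0⊎1 b       zero    = inj₁ refl
  less≡0⊎1 zero    (suc n) = inj₂ refl
  less≡0⊎1 (suc b) (suc n) = less≡0⊎1 b n

  less≡1⇒< : ∀ b n → less b n ≡ 1 → b < n
  less≡1⇒< zero    (suc n) _ = s≤s z≤n
  less≡1⇒< (suc b) (suc n) eq = s≤s (less≡1⇒< b n eq)

  <⇒less≡1 : ∀ b n → b < n → less b n ≡ 1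
  <⇒less≡1 zero    (suc n) _         = refl
  <⇒less≡1 (suc b) (suc n) (s≤s b<n) = <⇒less≡1 b n b<n

coefficient≡0⊎1 : ∀ a b n → coefficient a b n ≡ 0 ⊎ coefficient a b n ≡ 1
coefficient≡0⊎1 zero    zero    zero    = inj₂ refl
coefficient≡0⊎1 zero    zero    (suc n) = inj₁ refl
coefficient≡0⊎1 zero    (suc b) zero    = inj₁ refl
coefficient≡0⊎1 zero    (suc b) (suc n) = less≡0⊎1 b n
coefficient≡0⊎1 (suc a) b       zero    = inj₁ refl
coefficient≡0⊎1 (suc a) b       (suc n) = coefficient≡0⊎1 a b n

coefficient≡1⇒admissible : ∀ a b n → coefficient a b n ≡ 1 → Admissible a b n
coefficient≡1⇒admissible zero    zero    zero    _  = inj₁ (refl , refl)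
coefficient≡1⇒admissible zero    (suc b) (suc n) eq = inj₂ (s≤s z≤n , s≤s (less≡1⇒< b n eq))
coefficient≡1⇒admissible (suc a) b       (suc n) eq with coefficient≡1⇒admissible a b n eq
... | inj₁ (b≡0 , a≡n)   = inj₁ (b≡0 , cong suc a≡n)
... | inj₂ (0<b , a+b<n) = inj₂ (0<b , s≤s a+b<n)

admissible⇒coefficient≡1 : ∀ a b n → Admissible a b n → coefficient a b n ≡ 1
admissible⇒coefficient≡1 zero    zero    .zero    (inj₁ (refl , refl)) = refl
admissible⇒coefficient≡1 (suc a) .zero   .(suc a) (inj₁ (refl , refl)) =
  admissible⇒coefficient≡1 a 0 a (inj₁ (refl , refl))
admissible⇒coefficient≡1 zero    (suc b) (suc n)  (inj₂ (_ , s≤s b<n)) = <⇒less≡1 b n b<n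
admissible⇒coefficient≡1 (suc a) b       (suc n)  (inj₂ (0<b , s≤s a+b<n)) =
  admissible⇒coefficient≡1 a b n (inj₂ (0<b , a+b<n))

canonical⇒admissible : ∀ {e o n} → CanonicalBlocks e o → e + o ≤ n → Admissible (n ∸ (e + o)) e n
canonical⇒admissible         (inj₁ (refl , refl)) _       = inj₁ (refl , refl)
canonical⇒admissible {e} {o} {n} (inj₂ (0<e , 0<o)) e+o≤n = inj₂ (0<e , x+e<n)
  where
  x = n ∸ (e + o)
  x+e<n : x + e < n
  x+e<n = subst (x + e <_) (trans (+-assoc x e o) (m∸n+n≡m e+o≤n)) (m<m+n (x + e) 0<o)

admissible⇒canonical : ∀ {a b n} → Admissible a b n → ∃[ o ] CanonicalBlocks b o × b + o ≤ n × n ∸ (b + o) ≡ a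
admissible⇒canonical {n = n} (inj₁ (refl , refl)) = 0 , inj₁ (refl , refl) , z≤n , refl
admissible⇒canonical {a} {b} {n} (inj₂ (0<b , a+b<n)) =
  o , inj₂ (0<b , m<n⇒0<n∸m a+b<n) ,
  subst (b + o ≤_) n≡ (+-monoˡ-≤ o (m≤n+m b a)) ,
  trans (cong (_∸ (b + o)) (sym n≡)) (trans (cong (_∸ (b + o)) (+-assoc a b o)) (m+n∸n≡m a (b + o)))
  where
  o = n ∸ (a + b)
  n≡ : (a + b) + o ≡ n
  n≡ = m+[n∸m]≡n (<⇒≤ a+b<n)

blocks-determined : ∀ {e o o′ n} → e + o ≤ n → e + o′ ≤ n → n ∸ (e + o) ≡ n ∸ (e + o′) → o ≡ o′
blocks-determined {e} e+o≤n e+o′≤n eq = +-cancelˡ-≡ e _ _ (∸-cancelˡ-≡ e+o≤n e+o′≤n eq)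

-- e is the number of excedances of shape n e o and o the size of the other block.
record BlockClassification (Σs : List (Vec (Fin 3) 3)) : Set where
  field
    shape     : ℕ → ℕ → ℕ → ℕ → ℕ
    classify  : ∀ {n} (w : Vec (Fin n) n) → IsPerm w → Avoids w Σs →
                ∃₂ λ e o → CanonicalBlocks e o × e + o ≤ n × AgreeOn n (entry w) (shape n e o)
    realise   : ∀ {n e o} → CanonicalBlocks e o → e + o ≤ n →
                ∃ λ (w : Vec (Fin n) n) → IsPerm w × Avoids w Σs × AgreeOn n (entry w) (shape n e o)
    fp-shape  : ∀ {n e o} → CanonicalBlocks e o → e + o ≤ n →
                (w : Vec (Fin n) n) → AgreeOn n (entry w) (shape n e o) → fp w ≡ n ∸ (e + o)
    exc-shape : ∀ {n e o} → CanonicalBlocks e o → e + o ≤ n →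
                (w : Vec (Fin n) n) → AgreeOn n (entry w) (shape n e o) → exc w ≡ e

module _ {Σs} (classification : BlockClassification Σs) where

  open BlockClassification classification

  count≡coefficient : ∀ a b n → count Σs a b n ≡ coefficient a b n
  count≡coefficient a b n with coefficient≡0⊎1 a b n
  ... | inj₁ c≡0 = trans (length-filter-none _ (allWords n n) none) (sym c≡0)
    where
    none : ∀ w → ¬ (IsPerm w × Avoids w Σs × fp w ≡ a × exc w ≡ b)
    none w (perm , avoids , fp≡a , exc≡b) with classify w perm avoids
    ... | e , o , canonical , fits , agree =
      0≢1+n (trans (sym c≡0) (admissible⇒coefficient≡1 a b n
        (subst₂ (λ x y → Admissible x y n) (trans (sym (fp-shape canonical fits w agree)) fp≡a)
          (trans (sym (exc-shape canonical fits w agree)) exc≡b) (canonical⇒admissible canonical fits))))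
  ... | inj₂ c≡1 with admissible⇒canonical (coefficient≡1⇒admissible a b n c≡1)
  ...   | o , canonical , fits , n∸[b+o]≡a with realise canonical fits
  ...     | t , perm , avoids , agree =
    trans (length-filter-allWords-unique n _ t
            (perm , avoids , trans (fp-shape canonical fits t agree) n∸[b+o]≡a , exc-shape canonical fits t agree)
            unique)
          (sym c≡1)
    where
    unique : ∀ w → IsPerm w × Avoids w Σs × fp w ≡ a × exc w ≡ b → w ≡ t
    unique w (perm′ , avoids′ , fp≡a , exc≡b) with classify w perm′ avoids′
    ... | e′ , o′ , canonical′ , fits′ , agree′ with trans (sym (exc-shape canonical′ fits′ w agree′)) exc≡b
    ...   | refl = entry-injective w t (λ m m<n →
      trans (agree′ m m<n) (trans (cong (λ o → shape n b o m) o′≡o) (sym (agree m m<n))))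
      where
      o′≡o = blocks-determined fits′ fits (trans (sym (fp-shape canonical′ fits′ w agree′)) (trans fp≡a (sym n∸[b+o]≡a)))

avoiders132-321 : BlockClassification (p132 ∷ p321 ∷ [])
avoiders132-321 = record
  { shape     = λ _ → swapBlocks
  ; classify  = classify
  ; realise   = realise
  ; fp-shape  = fp-shape
  ; exc-shape = exc-shape
  }
  where
  classify : ∀ {n} (w : Vec (Fin n) n) → IsPerm w → Avoids w (p132 ∷ p321 ∷ []) →
             ∃₂ λ e o → CanonicalBlocks e o × e + o ≤ n × AgreeOn n (entry w) (swapBlocks e o)
  classify {zero}  w _    _                  = 0 , 0 , inj₁ (refl , refl) , z≤n , λ _ ()
  classify {suc n} w perm (¬132 ∷ ¬321 ∷ []) = z , K , canonical , fits , agrees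
    where
    open AvoiderStructure (entry-maps-into w) (entry-injectiveOn w perm) (entry-surjective w perm)
                          (¬contains⇒avoids132 w ¬132) (¬contains⇒avoids321 w ¬321) (s≤s z≤n)

  realise : ∀ {n e o} → CanonicalBlocks e o → e + o ≤ n →
            ∃ λ (w : Vec (Fin n) n) → IsPerm w × Avoids w (p132 ∷ p321 ∷ []) × AgreeOn n (entry w) (swapBlocks e o)
  realise {e = e} {o} canonical fits =
    w , perm , (avoids132⇒¬contains w agree perm σ.avoids132 ∷ avoids321⇒¬contains w agree perm σ.avoids321 ∷ []) , agree
    where
    module σ = SwapBlocks canonical
    maps  = σ.maps-into fits
    w     = fromFunction (swapBlocks e o) maps
    perm  = fromFunction-isPerm (swapBlocks e o) maps σ.injective
    agree = entry-fromFunction (swapBlocks e o) maps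

  fp-shape : ∀ {n e o} → CanonicalBlocks e o → e + o ≤ n →
             (w : Vec (Fin n) n) → AgreeOn n (entry w) (swapBlocks e o) → fp w ≡ n ∸ (e + o)
  fp-shape {n} {e} {o} canonical fits w agree =
    fp-interval w agree (e + o) n fits ≤-refl (λ m e+o≤m _ → swapBlocks-fixed {e} {o} e+o≤m) (λ m m<n eq → fixed⇒ m eq , m<n)
    where open SwapBlocks canonical

  exc-shape : ∀ {n e o} → CanonicalBlocks e o → e + o ≤ n →
              (w : Vec (Fin n) n) → AgreeOn n (entry w) (swapBlocks e o) → exc w ≡ e
  exc-shape {e = e} {o} canonical fits w agree =
    exc-interval w agree 0 e z≤n (≤-trans (m≤m+n e o) fits)
      (λ m _ m<e → excedance⇐ m m<e) (λ m _ m<σm → z≤n , excedance⇒ m m<σm)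
    where open SwapBlocks canonical

-- (swapBlocks o e)^rc has e excedances, one for each deficiency of swapBlocks o e.
avoiders213-321 : BlockClassification (p213 ∷ p321 ∷ [])
avoiders213-321 = record
  { shape     = shape
  ; classify  = classify
  ; realise   = realise
  ; fp-shape  = fp-shape
  ; exc-shape = exc-shape
  }
  where
  shape : ℕ → ℕ → ℕ → ℕ → ℕ
  shape n e o = reverseComplement n (swapBlocks o e)

  module Shape {n e o} (canonical : CanonicalBlocks e o) (fits : e + o ≤ n) where
    module σ = SwapBlocks (canonicalBlocks-sym canonical)
    module ρ = ReverseComplement (σ.maps-into (subst (_≤ n) (+-comm e o) fits))

    fixed⇐ : ∀ m → m < n ∸ (o + e) → shape n e o m ≡ m
    fixed⇐ m m<n∸[o+e] =
      ρ.fixed⇐ m (<-≤-trans m<n∸[o+e] (m∸n≤m n (o + e))) (swapBlocks-fixed {o} {e} (reflect-≤⁻¹ m<n∸[o+e]))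

    fixed⇒ : ∀ m → m < n → shape n e o m ≡ m → m < n ∸ (o + e)
    fixed⇒ m m<n σm≡m = reflect-≤ m<n (σ.fixed⇒ _ (ρ.fixed⇒ m m<n σm≡m))

    excedance⇐ : ∀ m → n ∸ (o + e) ≤ m → m < n ∸ o → m < shape n e o m
    excedance⇐ m n∸[o+e]≤m m<n∸o =
      ρ.excedance⇐ m m<n
        (σ.deficiency⇐ _ (reflect-≤⁻¹ m<n∸o) (≰⇒> (λ o+e≤ → <⇒≱ (reflect-≤ m<n o+e≤) n∸[o+e]≤m)))
      where m<n = <-≤-trans m<n∸o (m∸n≤m n o)

    excedance⇒ : ∀ m → m < n → m < shape n e o m → n ∸ (o + e) ≤ m × m < n ∸ o
    excedance⇒ m m<n lt with σ.deficiency⇒ _ (ρ.excedance⇒ m m<n lt)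
    ... | o≤ , <o+e = ≮⇒≥ (λ m<n∸[o+e] → <⇒≱ <o+e (reflect-≤⁻¹ m<n∸[o+e])) , reflect-≤ m<n o≤

  classify : ∀ {n} (w : Vec (Fin n) n) → IsPerm w → Avoids w (p213 ∷ p321 ∷ []) →
             ∃₂ λ e o → CanonicalBlocks e o × e + o ≤ n × AgreeOn n (entry w) (shape n e o)
  classify {zero}  w _    _                  = 0 , 0 , inj₁ (refl , refl) , z≤n , λ _ ()
  classify {suc n} w perm (¬213 ∷ ¬321 ∷ []) =
    K , z , canonicalBlocks-sym canonical , subst (_≤ suc n) (+-comm z K) fits ,
    λ m m<n → trans (sym (ρ.involutive m m<n)) (reverseComplement-cong agrees m m<n)
    where
    module ρ = ReverseComplement (entry-maps-into w)
    open AvoiderStructure ρ.maps-into (ρ.injective (entry-injectiveOn w perm)) (ρ.surjective (entry-surjective w perm))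
                          (ρ.avoids132 (¬contains⇒avoids213 w ¬213)) (ρ.avoids321 (¬contains⇒avoids321 w ¬321)) (s≤s z≤n)

  realise : ∀ {n e o} → CanonicalBlocks e o → e + o ≤ n →
            ∃ λ (w : Vec (Fin n) n) → IsPerm w × Avoids w (p213 ∷ p321 ∷ []) × AgreeOn n (entry w) (shape n e o)
  realise {n} {e} {o} canonical fits =
    w , perm ,
    (avoids213⇒¬contains w agree perm (ρ.avoids213 σ.avoids132) ∷
     avoids321⇒¬contains w agree perm (ρ.avoids321 σ.avoids321) ∷ []) ,
    agree
    where
    open Shape canonical fits
    w     = fromFunction (shape n e o) ρ.maps-into
    perm  = fromFunction-isPerm (shape n e o) ρ.maps-into (ρ.injective σ.injective)
    agree = entry-fromFunction (shape n e o) ρ.maps-into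

  fp-shape : ∀ {n e o} → CanonicalBlocks e o → e + o ≤ n →
             (w : Vec (Fin n) n) → AgreeOn n (entry w) (shape n e o) → fp w ≡ n ∸ (e + o)
  fp-shape {n} {e} {o} canonical fits w agree =
    trans (fp-interval w agree 0 (n ∸ (o + e)) z≤n (m∸n≤m n (o + e))
             (λ m _ → fixed⇐ m) (λ m m<n σm≡m → z≤n , fixed⇒ m m<n σm≡m))
          (cong (n ∸_) (+-comm o e))
    where open Shape canonical fits

  exc-shape : ∀ {n e o} → CanonicalBlocks e o → e + o ≤ n →
              (w : Vec (Fin n) n) → AgreeOn n (entry w) (shape n e o) → exc w ≡ e
  exc-shape {n} {e} {o} canonical fits w agree =
    trans (exc-interval w agree (n ∸ (o + e)) (n ∸ o) (∸-monoʳ-≤ n (m≤m+n o e)) (m∸n≤m n o) excedance⇐ excedance⇒)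
      (trans (cong (n ∸ o ∸_) (sym (∸-+-assoc n o e))) (m∸[m∸n]≡n (m+n≤o⇒m≤o∸n e fits)))
    where open Shape canonical fits

-- Formal power series

≈ₛ-sym : ∀ {f g} → f ≈ₛ g → g ≈ₛ f
≈ₛ-sym f≈g a b n = sym (f≈g a b n)

≈ₛ-trans : ∀ {f g h} → f ≈ₛ g → g ≈ₛ h → f ≈ₛ h
≈ₛ-trans f≈g g≈h a b n = trans (f≈g a b n) (g≈h a b n)

δ : ℕ → ℕ → ℤ
δ x y = + indicator (x ≟ y)

δ-≡ : ∀ x y → x ≡ y → δ x y ≡ + 1
δ-≡ x y x≡y = cong +_ (indicator-yes (x ≟ y) x≡y)

δ-≢ : ∀ x y → x ≢ y → δ x y ≡ + 0
δ-≢ x y x≢y = cong +_ (indicator-no (x ≟ y) x≢y)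

mono≡δ*δ*δ : ∀ i j k a b n → mono i j k a b n ≡ δ i a ℤ.* (δ j b ℤ.* δ k n)
mono≡δ*δ*δ i j k a b n with i ≟ a | j ≟ b | k ≟ n
... | yes _ | yes _ | yes _ = refl
... | yes _ | yes _ | no _  = refl
... | yes _ | no _  | yes _ = refl
... | yes _ | no _  | no _  = refl
... | no _  | yes _ | yes _ = refl
... | no _  | yes _ | no _  = refl
... | no _  | no _  | yes _ = refl
... | no _  | no _  | no _  = refl

sumTo-cong : ∀ n {f g : ℕ → ℤ} → (∀ i → f i ≡ g i) → sumTo n f ≡ sumTo n g
sumTo-cong zero    f≡g = f≡g 0
sumTo-cong (suc n) f≡g = cong₂ ℤ._+_ (sumTo-cong n f≡g) (f≡g (suc n))

sumTo-zero : ∀ n (f : ℕ → ℤ) → (∀ i → i ≤ n → f i ≡ + 0) → sumTo n f ≡ + 0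
sumTo-zero zero    f f≡0 = f≡0 0 z≤n
sumTo-zero (suc n) f f≡0 = cong₂ ℤ._+_ (sumTo-zero n f (λ i i≤n → f≡0 i (m≤n⇒m≤1+n i≤n))) (f≡0 (suc n) ≤-refl)

sumTo-single : ∀ n (f : ℕ → ℤ) p → p ≤ n → (∀ i → i ≤ n → i ≢ p → f i ≡ + 0) → sumTo n f ≡ f p
sumTo-single zero    f .0 z≤n _   = refl
sumTo-single (suc n) f p  p≤1+n f≡0 with p ≟ suc n
... | yes refl =
  trans (cong (ℤ._+ f (suc n)) (sumTo-zero n f (λ i i≤n → f≡0 i (m≤n⇒m≤1+n i≤n) (<⇒≢ (s≤s i≤n)))))
        (ℤ.+-identityˡ _)
... | no p≢1+n =
  trans (cong₂ ℤ._+_ (sumTo-single n f p (s≤s⁻¹ (≤∧≢⇒< p≤1+n p≢1+n)) (λ i i≤n → f≡0 i (m≤n⇒m≤1+n i≤n)))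
                   (f≡0 (suc n) ≤-refl (p≢1+n ∘ sym)))
        (ℤ.+-identityʳ _)

sumTo-*ˡ : ∀ n c (f : ℕ → ℤ) → sumTo n (λ i → c ℤ.* f i) ≡ c ℤ.* sumTo n f
sumTo-*ˡ zero    c f = refl
sumTo-*ˡ (suc n) c f = trans (cong (ℤ._+ c ℤ.* f (suc n)) (sumTo-*ˡ n c f)) (sym (ℤ.*-distribˡ-+ c (sumTo n f) (f (suc n))))

sumTo-+ : ∀ n (f g : ℕ → ℤ) → sumTo n (λ i → f i ℤ.+ g i) ≡ sumTo n f ℤ.+ sumTo n g
sumTo-+ zero    f g = refl
sumTo-+ (suc n) f g =
  trans (cong (ℤ._+ (f (suc n) ℤ.+ g (suc n))) (sumTo-+ n f g))
        (interchange (sumTo n f) (sumTo n g) (f (suc n)) (g (suc n)))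
  where
  interchange : ∀ a b c d → (a ℤ.+ b) ℤ.+ (c ℤ.+ d) ≡ (a ℤ.+ c) ℤ.+ (b ℤ.+ d)
  interchange = solve-∀

sumTo-- : ∀ n (f g : ℕ → ℤ) → sumTo n (λ i → f i ℤ.- g i) ≡ sumTo n f ℤ.- sumTo n g
sumTo-- zero    f g = refl
sumTo-- (suc n) f g =
  trans (cong (ℤ._+ (f (suc n) ℤ.- g (suc n))) (sumTo-- n f g))
        (interchange (sumTo n f) (sumTo n g) (f (suc n)) (g (suc n)))
  where
  interchange : ∀ a b c d → (a ℤ.- b) ℤ.+ (c ℤ.- d) ≡ (a ℤ.+ c) ℤ.- (b ℤ.+ d)
  interchange = solve-∀

guard : Bool → ℤ → ℤ
guard true  x = x
guard false _ = + 0

private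
  ≤ᵇ-false : ∀ {k n} → (k ≤ᵇ n) ≡ false → ¬ (k ≤ n)
  ≤ᵇ-false k≤ᵇn≡false k≤n = subst T k≤ᵇn≡false (≤⇒≤ᵇ k≤n)

  ≤ᵇ-true : ∀ {k n} → (k ≤ᵇ n) ≡ true → k ≤ n
  ≤ᵇ-true {k} {n} k≤ᵇn≡true = ≤ᵇ⇒≤ k n (subst T (sym k≤ᵇn≡true) _)

sumTo-δ : ∀ n k (h : ℕ → ℤ) → sumTo n (λ k′ → δ k (n ∸ k′) ℤ.* h k′) ≡ guard (k ≤ᵇ n) (h (n ∸ k))
sumTo-δ n k h with k ≤ᵇ n in eq
... | true = trans (sumTo-single n (λ k′ → δ k (n ∸ k′) ℤ.* h k′) (n ∸ k) (m∸n≤m n k) off-diagonal)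
                   (trans (cong (ℤ._* h (n ∸ k)) (δ-≡ k (n ∸ (n ∸ k)) (sym (m∸[m∸n]≡n (≤ᵇ-true eq))))) (ℤ.*-identityˡ _))
  where
  off-diagonal : ∀ i → i ≤ n → i ≢ n ∸ k → δ k (n ∸ i) ℤ.* h i ≡ + 0
  off-diagonal i i≤n i≢n∸k =
    cong (ℤ._* h i) (δ-≢ k (n ∸ i) (λ k≡n∸i → i≢n∸k (trans (sym (m∸[m∸n]≡n i≤n)) (cong (n ∸_) (sym k≡n∸i)))))
... | false = sumTo-zero n (λ k′ → δ k (n ∸ k′) ℤ.* h k′) λ i _ →
  cong (ℤ._* h i) (δ-≢ k (n ∸ i) (λ k≡n∸i → ≤ᵇ-false eq (subst (_≤ n) (sym k≡n∸i) (m∸n≤m n i))))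

shift : ℕ → ℕ → ℕ → Series → Series
shift i j k f a b n = guard (i ≤ᵇ a) (guard (j ≤ᵇ b) (guard (k ≤ᵇ n) (f (a ∸ i) (b ∸ j) (n ∸ k))))

⊛-mono : ∀ f i j k → (f ⊛ mono i j k) ≈ₛ shift i j k f
⊛-mono f i j k a b n =
  trans (sumTo-cong a λ i′ → sumTo-cong b λ j′ → sumTo-cong n λ k′ →
           trans (cong (f i′ j′ k′ ℤ.*_) (mono≡δ*δ*δ i j k (a ∸ i′) (b ∸ j′) (n ∸ k′)))
                 (rotate (f i′ j′ k′) (δ i (a ∸ i′)) (δ j (b ∸ j′)) (δ k (n ∸ k′))))
  (trans (sumTo-cong a λ i′ →
           trans (sumTo-cong b λ j′ → sumTo-*ˡ n (δ i (a ∸ i′)) λ k′ → δ j (b ∸ j′) ℤ.* (δ k (n ∸ k′) ℤ.* f i′ j′ k′))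
                 (sumTo-*ˡ b (δ i (a ∸ i′)) λ j′ → sumTo n λ k′ → δ j (b ∸ j′) ℤ.* (δ k (n ∸ k′) ℤ.* f i′ j′ k′)))
  (trans (sumTo-cong a λ i′ → cong (δ i (a ∸ i′) ℤ.*_)
           (trans (sumTo-cong b λ j′ → sumTo-*ˡ n (δ j (b ∸ j′)) λ k′ → δ k (n ∸ k′) ℤ.* f i′ j′ k′)
           (trans (sumTo-cong b λ j′ → cong (δ j (b ∸ j′) ℤ.*_) (sumTo-δ n k (f i′ j′)))
                  (sumTo-δ b j λ j′ → guard (k ≤ᵇ n) (f i′ j′ (n ∸ k))))))
         (sumTo-δ a i λ i′ → guard (j ≤ᵇ b) (guard (k ≤ᵇ n) (f i′ (b ∸ j) (n ∸ k))))))
  where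
  rotate : ∀ x p q r → x ℤ.* (p ℤ.* (q ℤ.* r)) ≡ p ℤ.* (q ℤ.* (r ℤ.* x))
  rotate = solve-∀

⊛-distribˡ-⊕ : ∀ f g h → (f ⊛ (g ⊕ h)) ≈ₛ ((f ⊛ g) ⊕ (f ⊛ h))
⊛-distribˡ-⊕ f g h a b n =
  trans (sumTo-cong a λ i′ → sumTo-cong b λ j′ →
           trans (sumTo-cong n λ k′ →
                    ℤ.*-distribˡ-+ (f i′ j′ k′) (g (a ∸ i′) (b ∸ j′) (n ∸ k′)) (h (a ∸ i′) (b ∸ j′) (n ∸ k′)))
                 (sumTo-+ n _ _))
        (trans (sumTo-cong a λ i′ → sumTo-+ b _ _) (sumTo-+ a _ _))

⊛-distribˡ-⊖ : ∀ f g h → (f ⊛ (g ⊖ h)) ≈ₛ ((f ⊛ g) ⊖ (f ⊛ h))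
⊛-distribˡ-⊖ f g h a b n =
  trans (sumTo-cong a λ i′ → sumTo-cong b λ j′ →
           trans (sumTo-cong n λ k′ →
                    *-distribˡ-- (f i′ j′ k′) (g (a ∸ i′) (b ∸ j′) (n ∸ k′)) (h (a ∸ i′) (b ∸ j′) (n ∸ k′)))
                 (sumTo-- n _ _))
        (trans (sumTo-cong a λ i′ → sumTo-- b _ _) (sumTo-- a _ _))
  where
  *-distribˡ-- : ∀ x y z → x ℤ.* (y ℤ.- z) ≡ x ℤ.* y ℤ.- x ℤ.* z
  *-distribˡ-- = solve-∀

⊛-congˡ : ∀ f {g g′} → g ≈ₛ g′ → (f ⊛ g) ≈ₛ (f ⊛ g′)
⊛-congˡ f g≈g′ a b n =
  sumTo-cong a λ i′ → sumTo-cong b λ j′ → sumTo-cong n λ k′ → cong (f i′ j′ k′ ℤ.*_) (g≈g′ _ _ _)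

⊛-congʳ : ∀ {f f′} g → f ≈ₛ f′ → (f ⊛ g) ≈ₛ (f′ ⊛ g)
⊛-congʳ g f≈f′ a b n =
  sumTo-cong a λ i′ → sumTo-cong b λ j′ → sumTo-cong n λ k′ → cong (ℤ._* g (a ∸ i′) (b ∸ j′) (n ∸ k′)) (f≈f′ _ _ _)

private
  guard-+ : ∀ p x y → guard p (x ℤ.+ y) ≡ guard p x ℤ.+ guard p y
  guard-+ true  x y = refl
  guard-+ false x y = refl

  guard-- : ∀ p x y → guard p (x ℤ.- y) ≡ guard p x ℤ.- guard p y
  guard-- true  x y = refl
  guard-- false x y = refl

  guard-* : ∀ p q r x y z → guard p (guard q (guard r (x ℤ.* (y ℤ.* z)))) ≡ guard p x ℤ.* (guard q y ℤ.* guard r z)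
  guard-* true  true  true  x y z = refl
  guard-* true  true  false x y z = sym (trans (cong (x ℤ.*_) (ℤ.*-zeroʳ y)) (ℤ.*-zeroʳ x))
  guard-* true  false r     x y z = sym (trans (cong (x ℤ.*_) (ℤ.*-zeroˡ (guard r z))) (ℤ.*-zeroʳ x))
  guard-* false q     r     x y z = refl

  guard-δ : ∀ i′ i a → guard (i ≤ᵇ a) (δ i′ (a ∸ i)) ≡ δ (i′ + i) a
  guard-δ i′ i a with i ≤ᵇ a in eq
  ... | false = sym (δ-≢ (i′ + i) a (λ i′+i≡a → ≤ᵇ-false eq (subst (i ≤_) i′+i≡a (m≤n+m i i′))))
  ... | true with i′ ≟ a ∸ i
  ...   | yes i′≡a∸i = sym (δ-≡ (i′ + i) a (trans (cong (λ x → x + i) i′≡a∸i) (m∸n+n≡m (≤ᵇ-true {i} {a} eq))))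
  ...   | no i′≢a∸i  = sym (δ-≢ (i′ + i) a (λ i′+i≡a → i′≢a∸i (trans (sym (m+n∸n≡m i′ i)) (cong (_∸ i) i′+i≡a))))

shift-⊕ : ∀ i j k f g → shift i j k (f ⊕ g) ≈ₛ (shift i j k f ⊕ shift i j k g)
shift-⊕ i j k f g a b n =
  trans (cong (guard (i ≤ᵇ a)) (trans (cong (guard (j ≤ᵇ b)) (guard-+ (k ≤ᵇ n) _ _)) (guard-+ (j ≤ᵇ b) _ _)))
        (guard-+ (i ≤ᵇ a) _ _)

shift-⊖ : ∀ i j k f g → shift i j k (f ⊖ g) ≈ₛ (shift i j k f ⊖ shift i j k g)
shift-⊖ i j k f g a b n =
  trans (cong (guard (i ≤ᵇ a)) (trans (cong (guard (j ≤ᵇ b)) (guard-- (k ≤ᵇ n) _ _)) (guard-- (j ≤ᵇ b) _ _)))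
        (guard-- (i ≤ᵇ a) _ _)

shift-mono : ∀ i j k i′ j′ k′ → shift i j k (mono i′ j′ k′) ≈ₛ mono (i′ + i) (j′ + j) (k′ + k)
shift-mono i j k i′ j′ k′ a b n =
  trans (cong (guard (i ≤ᵇ a)) (cong (guard (j ≤ᵇ b)) (cong (guard (k ≤ᵇ n)) (mono≡δ*δ*δ i′ j′ k′ (a ∸ i) (b ∸ j) (n ∸ k)))))
  (trans (guard-* (i ≤ᵇ a) (j ≤ᵇ b) (k ≤ᵇ n) _ _ _)
  (trans (cong₂ ℤ._*_ (guard-δ i′ i a) (cong₂ ℤ._*_ (guard-δ j′ j b) (guard-δ k′ k n)))
         (sym (mono≡δ*δ*δ (i′ + i) (j′ + j) (k′ + k) a b n))))

-- Polynomials as formal combinations of monomials, so that products can be expanded by recursion.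
infixl 6 _⊕ₚ_ _⊖ₚ_

data Poly : Set where
  monoₚ      : ℕ → ℕ → ℕ → Poly
  _⊖ₚ_ _⊕ₚ_ : Poly → Poly → Poly

⟦_⟧ : Poly → Series
⟦ monoₚ i j k ⟧ = mono i j k
⟦ p ⊖ₚ p′ ⟧     = ⟦ p ⟧ ⊖ ⟦ p′ ⟧
⟦ p ⊕ₚ p′ ⟧     = ⟦ p ⟧ ⊕ ⟦ p′ ⟧

shiftₚ : ℕ → ℕ → ℕ → Poly → Poly
shiftₚ i j k (monoₚ i′ j′ k′) = monoₚ (i′ + i) (j′ + j) (k′ + k)
shiftₚ i j k (p ⊖ₚ p′)        = shiftₚ i j k p ⊖ₚ shiftₚ i j k p′
shiftₚ i j k (p ⊕ₚ p′)        = shiftₚ i j k p ⊕ₚ shiftₚ i j k p′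

infixl 7 _⊛ₚ_

_⊛ₚ_ : Poly → Poly → Poly
p ⊛ₚ monoₚ i j k = shiftₚ i j k p
p ⊛ₚ (p′ ⊖ₚ p″)  = p ⊛ₚ p′ ⊖ₚ p ⊛ₚ p″
p ⊛ₚ (p′ ⊕ₚ p″)  = p ⊛ₚ p′ ⊕ₚ p ⊛ₚ p″

shifts : Series → Poly → Series
shifts f (monoₚ i j k) = shift i j k f
shifts f (p ⊖ₚ p′)     = shifts f p ⊖ shifts f p′
shifts f (p ⊕ₚ p′)     = shifts f p ⊕ shifts f p′

⊛-⟦⟧ : ∀ f p → (f ⊛ ⟦ p ⟧) ≈ₛ shifts f p
⊛-⟦⟧ f (monoₚ i j k) = ⊛-mono f i j k
⊛-⟦⟧ f (p ⊖ₚ p′) a b n =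
  trans (⊛-distribˡ-⊖ f ⟦ p ⟧ ⟦ p′ ⟧ a b n) (cong₂ ℤ._-_ (⊛-⟦⟧ f p a b n) (⊛-⟦⟧ f p′ a b n))
⊛-⟦⟧ f (p ⊕ₚ p′) a b n =
  trans (⊛-distribˡ-⊕ f ⟦ p ⟧ ⟦ p′ ⟧ a b n) (cong₂ ℤ._+_ (⊛-⟦⟧ f p a b n) (⊛-⟦⟧ f p′ a b n))

shift-⟦⟧ : ∀ i j k p → shift i j k ⟦ p ⟧ ≈ₛ ⟦ shiftₚ i j k p ⟧
shift-⟦⟧ i j k (monoₚ i′ j′ k′) = shift-mono i j k i′ j′ k′
shift-⟦⟧ i j k (p ⊖ₚ p′) a b n =
  trans (shift-⊖ i j k ⟦ p ⟧ ⟦ p′ ⟧ a b n) (cong₂ ℤ._-_ (shift-⟦⟧ i j k p a b n) (shift-⟦⟧ i j k p′ a b n))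
shift-⟦⟧ i j k (p ⊕ₚ p′) a b n =
  trans (shift-⊕ i j k ⟦ p ⟧ ⟦ p′ ⟧ a b n) (cong₂ ℤ._+_ (shift-⟦⟧ i j k p a b n) (shift-⟦⟧ i j k p′ a b n))

shifts-⟦⟧ : ∀ p p′ → shifts ⟦ p ⟧ p′ ≈ₛ ⟦ p ⊛ₚ p′ ⟧
shifts-⟦⟧ p (monoₚ i j k) = shift-⟦⟧ i j k p
shifts-⟦⟧ p (p′ ⊖ₚ p″) a b n = cong₂ ℤ._-_ (shifts-⟦⟧ p p′ a b n) (shifts-⟦⟧ p p″ a b n)
shifts-⟦⟧ p (p′ ⊕ₚ p″) a b n = cong₂ ℤ._+_ (shifts-⟦⟧ p p′ a b n) (shifts-⟦⟧ p p″ a b n)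

⟦⟧-⊛ : ∀ p p′ → (⟦ p ⟧ ⊛ ⟦ p′ ⟧) ≈ₛ ⟦ p ⊛ₚ p′ ⟧
⟦⟧-⊛ p p′ = ≈ₛ-trans (⊛-⟦⟧ ⟦ p ⟧ p′) (shifts-⟦⟧ p p′)

≈ₛ-refl : ∀ {f} → f ≈ₛ f
≈ₛ-refl a b n = refl

⊕-cong : ∀ {f f′ g g′} → f ≈ₛ f′ → g ≈ₛ g′ → (f ⊕ g) ≈ₛ (f′ ⊕ g′)
⊕-cong f≈f′ g≈g′ a b n = cong₂ ℤ._+_ (f≈f′ a b n) (g≈g′ a b n)

⊖-cong : ∀ {f f′ g g′} → f ≈ₛ f′ → g ≈ₛ g′ → (f ⊖ g) ≈ₛ (f′ ⊖ g′)
⊖-cong f≈f′ g≈g′ a b n = cong₂ ℤ._-_ (f≈f′ a b n) (g≈g′ a b n)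

⊛-cong : ∀ {f f′ g g′} → f ≈ₛ f′ → g ≈ₛ g′ → (f ⊛ g) ≈ₛ (f′ ⊛ g′)
⊛-cong {f′ = f′} {g} f≈f′ g≈g′ = ≈ₛ-trans (⊛-congʳ g f≈f′) (⊛-congˡ f′ g≈g′)

𝟙ₚ xₚ qₚ zₚ : Poly
𝟙ₚ = monoₚ 0 0 0
xₚ = monoₚ 1 0 0
qₚ = monoₚ 0 1 0
zₚ = monoₚ 0 0 1

denominatorₚ numeratorₚ : Poly
denominatorₚ = (𝟙ₚ ⊖ₚ zₚ) ⊛ₚ (𝟙ₚ ⊖ₚ xₚ ⊛ₚ zₚ) ⊛ₚ (𝟙ₚ ⊖ₚ qₚ ⊛ₚ zₚ)
numeratorₚ   = 𝟙ₚ ⊖ₚ (𝟙ₚ ⊕ₚ qₚ) ⊛ₚ zₚ ⊕ₚ (qₚ ⊕ₚ qₚ) ⊛ₚ zₚ ⊛ₚ zₚ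

denominator≈ : ((𝟙 ⊖ Z) ⊛ (𝟙 ⊖ X ⊛ Z) ⊛ (𝟙 ⊖ Q ⊛ Z)) ≈ₛ ⟦ denominatorₚ ⟧
denominator≈ =
  ≈ₛ-trans (⊛-cong (≈ₛ-trans (⊛-cong (≈ₛ-refl {𝟙 ⊖ Z}) (⊖-cong (≈ₛ-refl {𝟙}) (⟦⟧-⊛ xₚ zₚ)))
                              (⟦⟧-⊛ (𝟙ₚ ⊖ₚ zₚ) (𝟙ₚ ⊖ₚ xₚ ⊛ₚ zₚ)))
                   (⊖-cong (≈ₛ-refl {𝟙}) (⟦⟧-⊛ qₚ zₚ)))
           (⟦⟧-⊛ ((𝟙ₚ ⊖ₚ zₚ) ⊛ₚ (𝟙ₚ ⊖ₚ xₚ ⊛ₚ zₚ)) (𝟙ₚ ⊖ₚ qₚ ⊛ₚ zₚ))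

numerator≈ : (𝟙 ⊖ (𝟙 ⊕ Q) ⊛ Z ⊕ (Q ⊕ Q) ⊛ Z ⊛ Z) ≈ₛ ⟦ numeratorₚ ⟧
numerator≈ =
  ⊕-cong (⊖-cong (≈ₛ-refl {𝟙}) (⟦⟧-⊛ (𝟙ₚ ⊕ₚ qₚ) zₚ))
         (≈ₛ-trans (⊛-cong (⟦⟧-⊛ (qₚ ⊕ₚ qₚ) zₚ) (≈ₛ-refl {Z})) (⟦⟧-⊛ ((qₚ ⊕ₚ qₚ) ⊛ₚ zₚ) zₚ))

C : Series
C a b n = + coefficient a b n

private
  cancel₄ : ∀ p q r s → ((p ℤ.- q) ℤ.- (p ℤ.- q)) ℤ.- ((r ℤ.- s) ℤ.- (r ℤ.- s)) ≡ + 0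
  cancel₄ = solve-∀

  cancel₂ : ∀ p q → ((p ℤ.- q) ℤ.- (+ 0 ℤ.- + 0)) ℤ.- ((p ℤ.- q) ℤ.- (+ 0 ℤ.- + 0)) ≡ + 0
  cancel₂ = solve-∀

-- For a > 0 the terms cancel in pairs because C (1 + a) b (1 + n) = C a b n; for a = 0 they do so
-- once b ≥ 2 and n ≥ 3, because C 0 (1 + b) (1 + n) = C 0 b n; the remaining cases are computed.
C⊛denominator : shifts C denominatorₚ ≈ₛ ⟦ numeratorₚ ⟧
C⊛denominator zero zero zero = refl
C⊛denominator zero zero (suc zero) = refl
C⊛denominator zero zero (suc (suc n)) = refl
C⊛denominator zero (suc zero) zero = refl
C⊛denominator zero (suc zero) (suc zero) = refl
C⊛denominator zero (suc zero) (suc (suc zero)) = refl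
C⊛denominator zero (suc zero) (suc (suc (suc n))) = refl
C⊛denominator zero (suc (suc b)) zero = refl
C⊛denominator zero (suc (suc b)) (suc zero) = refl
C⊛denominator zero (suc (suc b)) (suc (suc zero)) = refl
C⊛denominator zero (suc (suc b)) n@(suc (suc (suc _))) =
  cancel₂ (shift 0 0 0 C 0 (suc (suc b)) n) (shift 0 0 1 C 0 (suc (suc b)) n)
C⊛denominator (suc a) b n@zero =
  cancel₄ (shift 0 0 0 C (suc a) b n) (shift 0 0 1 C (suc a) b n) (shift 0 1 1 C (suc a) b n) (shift 0 1 2 C (suc a) b n)
C⊛denominator (suc a) b n@(suc zero) =
  cancel₄ (shift 0 0 0 C (suc a) b n) (shift 0 0 1 C (suc a) b n) (shift 0 1 1 C (suc a) b n) (shift 0 1 2 C (suc a) b n)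
C⊛denominator (suc a) b n@(suc (suc zero)) =
  cancel₄ (shift 0 0 0 C (suc a) b n) (shift 0 0 1 C (suc a) b n) (shift 0 1 1 C (suc a) b n) (shift 0 1 2 C (suc a) b n)
C⊛denominator (suc a) b n@(suc (suc (suc _))) =
  cancel₄ (shift 0 0 0 C (suc a) b n) (shift 0 0 1 C (suc a) b n) (shift 0 1 1 C (suc a) b n) (shift 0 1 2 C (suc a) b n)

generating-function : ∀ Σs → (∀ a b n → count Σs a b n ≡ coefficient a b n) →
  (F Σs ⊛ ((𝟙 ⊖ Z) ⊛ (𝟙 ⊖ X ⊛ Z) ⊛ (𝟙 ⊖ Q ⊛ Z))) ≈ₛ (𝟙 ⊖ (𝟙 ⊕ Q) ⊛ Z ⊕ (Q ⊕ Q) ⊛ Z ⊛ Z)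
generating-function Σs count≡ =
  ≈ₛ-trans (⊛-cong (λ a b n → cong +_ (count≡ a b n)) denominator≈)
  (≈ₛ-trans (⊛-⟦⟧ C denominatorₚ) (≈ₛ-trans C⊛denominator (≈ₛ-sym numerator≈)))

proposition4p10 :
    ((F (p132 ∷ p321 ∷ []) ⊛ ((𝟙 ⊖ Z) ⊛ (𝟙 ⊖ X ⊛ Z) ⊛ (𝟙 ⊖ Q ⊛ Z)))
      ≈ₛ (𝟙 ⊖ (𝟙 ⊕ Q) ⊛ Z ⊕ (Q ⊕ Q) ⊛ Z ⊛ Z))
    ×
    ((F (p213 ∷ p321 ∷ []) ⊛ ((𝟙 ⊖ Z) ⊛ (𝟙 ⊖ X ⊛ Z) ⊛ (𝟙 ⊖ Q ⊛ Z)))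
      ≈ₛ (𝟙 ⊖ (𝟙 ⊕ Q) ⊛ Z ⊕ (Q ⊕ Q) ⊛ Z ⊛ Z))
proposition4p10 =
  generating-function _ (count≡coefficient avoiders132-321) ,
  generating-function _ (count≡coefficient avoiders213-321)
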